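{- Let $n \geq 5$, $1 \le k \le n$, and let $i_1, \dots, i_k \in [n]$ be distinct. Let $S_{n,k}^2$ be the subgraph of $S_n^2$ induced by $\bigcup_{t=1}^k V(S_n^{2:i_t})$. Then for every $t$ with $1 \le t \le k$, each edge of $S_n^{2:i_t}$ is contained in a Hamiltonian cycle of $S_{n,k}^2$.
   Context: For $n \geq 3$, the split-star network $S_n^2$ is the graph whose vertex set is the set of all permutations of $[n]$, written as strings $x_1x_2\cdots x_n$. Two distinct vertices $u = x_1\cdots x_n$ and $v = y_1\cdots y_n$ are adjacent iff one of the following holds: (i) $y_1 = x_2$, $y_2 = x_1$, $y_j = x_j$ for all $j \in [3,n]$; (ii) for some $i \in [3,n]$: $y_1 = x_2$, $y_2 = x_i$, $y_i = x_1$, $y_j = x_j$ for $j \in [3,n]\setminus\{i\}$; (iii) for some $i \in [3,n]$: $y_1 = x_i$, $y_2 = x_1$, $y_i = x_2$, $y_j = x_j$ for $j \in [3,n]\setminus\{i\}$. For $i \in [n]$, $S_n^{2:i}$ is the subgraph of $S_n^2$ induced by all vertices whose last symbol is $i$. -}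

module Defs where

open import Data.Nat using (ℕ; suc; _≤_; _∸_)
open import Data.Fin using (Fin; toℕ)
open import Data.Vec using (Vec; lookup)
open import Data.List using (List; _∷_; []; _++_; [_])
open import Data.List.Membership.Propositional using (_∈_)
open import Data.List.Relation.Unary.Unique.Propositional using (Unique)
open import Data.List.Relation.Unary.Linked using (Linked)
open import Data.Product using (Σ; ∃; ∃-syntax; _×_)
open import Data.Sum using (_⊎_)
open import Relation.Binary.PropositionalEquality using (_≡_; _≢_)
open import Relation.Nullary using (¬_)
open import Function.Definitions using (Injective)

-- Conventions: symbols [n] are Fin n (symbol s ↔ toℕ s + 1); positions 1..n
-- are Fin n as well (position p ↔ toℕ p + 1).  A string x₁⋯xₙ is a
-- Vec (Fin n) n, with x_p = lookup x p.

IsPerm : ∀ {n} → Vec (Fin n) n → Set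
IsPerm x = Injective _≡_ _≡_ (lookup x)

LastIs : ∀ {n} → Vec (Fin n) n → Fin n → Set
LastIs {n} x s = ∃[ p ] (suc (toℕ p) ≡ n × lookup x p ≡ s)

RuleI : ∀ {n} → Vec (Fin n) n → Vec (Fin n) n → Set
RuleI {n} x y = ∀ (a b : Fin n) → toℕ a ≡ 0 → toℕ b ≡ 1 →
  lookup y a ≡ lookup x b × lookup y b ≡ lookup x a ×
  (∀ (j : Fin n) → 2 ≤ toℕ j → lookup y j ≡ lookup x j)

RuleII : ∀ {n} → Vec (Fin n) n → Vec (Fin n) n → Set
RuleII {n} x y = ∃[ c ] (2 ≤ toℕ c × (∀ (a b : Fin n) → toℕ a ≡ 0 → toℕ b ≡ 1 →
  lookup y a ≡ lookup x b × lookup y b ≡ lookup x c × lookup y c ≡ lookup x a ×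
  (∀ (j : Fin n) → 2 ≤ toℕ j → j ≢ c → lookup y j ≡ lookup x j)))

RuleIII : ∀ {n} → Vec (Fin n) n → Vec (Fin n) n → Set
RuleIII {n} x y = ∃[ c ] (2 ≤ toℕ c × (∀ (a b : Fin n) → toℕ a ≡ 0 → toℕ b ≡ 1 →
  lookup y a ≡ lookup x c × lookup y b ≡ lookup x a × lookup y c ≡ lookup x b ×
  (∀ (j : Fin n) → 2 ≤ toℕ j → j ≢ c → lookup y j ≡ lookup x j)))

Adj : ∀ {n} → Vec (Fin n) n → Vec (Fin n) n → Set
Adj x y = x ≢ y × (RuleI x y ⊎ RuleII x y ⊎ RuleIII x y)

InSnk : ∀ {n k} → (Fin k → Fin n) → Vec (Fin n) n → Set
InSnk i x = IsPerm x × ∃[ t ] LastIs x (i t)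

-- A Hamiltonian cycle of S_{n,k}^2, given as its vertex sequence
-- v₀ ∷ vs (cycle v₀ → v₁ → ⋯ → v_m → v₀).
record HamCycle {n k : ℕ} (i : Fin k → Fin n) : Set where
  constructor hamCycle
  field
    v₀        : Vec (Fin n) n
    vs        : List (Vec (Fin n) n)
    length≥3  : Σ _ λ a → Σ _ λ b → Σ _ λ rest → vs ≡ a ∷ b ∷ rest
    distinct  : Unique (v₀ ∷ vs)
    inGraph   : ∀ {x} → x ∈ (v₀ ∷ vs) → InSnk i x
    spanning  : ∀ x → InSnk i x → x ∈ (v₀ ∷ vs)
    adjacent  : Linked Adj (v₀ ∷ vs ++ [ v₀ ])

EdgeOf : ∀ {n k} {i : Fin k → Fin n} →
         Vec (Fin n) n → Vec (Fin n) n → HamCycle i → Set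
EdgeOf u v C = ∃[ ys ] ∃[ zs ]
  ( (HamCycle.v₀ C ∷ HamCycle.vs C ++ [ HamCycle.v₀ C ] ≡ ys ++ u ∷ v ∷ zs)
  ⊎ (HamCycle.v₀ C ∷ HamCycle.vs C ++ [ HamCycle.v₀ C ] ≡ ys ++ v ∷ u ∷ zs))

{-# OPTIONS --safe #-}
-- Adjacency in S_n^2 is right multiplication of a permutation x by one of the generators of rules
-- (i)-(iii), acting on positions, so S_n^2 is a Cayley graph. For t ≥ 3 the permutations agreeing
-- with w beyond position t form a copy of S_{t+1}^2 (a level), split by the symbol at position t
-- into classes, each a copy of the level below. By induction on t: for every edge x y of a level and
-- every rung p — p·swap₀₁ (an edge of rule (i)) disjoint from it, some Hamiltonian path of the level
-- runs from y to x through that rung. The base case S_4^2 is settled by five explicit walks. In the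
-- step, a path through one class is extended class by class: a rung z — z·swap₀₁ of the current path,
-- with z chosen among four candidates to dodge three forbidden rungs, is replaced by the square
-- z — z·ii … z·ii·swap₀₁ — z·swap₀₁ enclosing a path through the remaining classes, and the class
-- of the prescribed rung is visited last. At the top level the classes i_t, i_1, …, i_k are chained
-- from v to u, and the edge u v closes the cycle.

module Submission where

open import Defs
open import Data.Nat as ℕ using (ℕ; zero; suc; _≤_; z≤n; s≤s)
import Data.Nat.Properties as ℕP
open import Data.Fin as F using (Fin; toℕ; zero; suc)
import Data.Fin.Properties as FP
open import Data.Vec as Vec using (Vec; lookup; tabulate)
import Data.Vec.Properties as VP
open import Data.List as List using (List; []; _∷_; _++_; [_]; map; filter; allFin; head; last)
import Data.List.Properties as List
open import Data.List.Properties using (++-assoc; map-++; ∷-injectiveʳ)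
open import Data.List.Membership.Propositional using (_∈_; _∉_)
open import Data.List.Membership.Propositional.Properties
  using (∈-++⁺ˡ; ∈-++⁺ʳ; ∈-++⁻; ∈-map⁺; ∈-map⁻; ∈-filter⁺; ∈-filter⁻; ∈-allFin)
import Data.List.Membership.DecPropositional as DecMembership
open import Data.List.Relation.Binary.Disjoint.Propositional using (Disjoint)
open import Data.List.Relation.Unary.Any using (here; there)
open import Data.List.Relation.Unary.All as All using (All; []; _∷_)
import Data.List.Relation.Unary.All.Properties as All
open import Data.List.Relation.Unary.Unique.Propositional using (Unique; []; _∷_)
import Data.List.Relation.Unary.Unique.Propositional.Properties as Unique
import Data.List.Relation.Unary.Unique.DecPropositional as DecUnique
open import Data.List.Relation.Unary.Linked using (Linked; []; [-]; _∷_)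
import Data.List.Relation.Unary.Linked.Properties as Linked
import Data.Maybe
open import Data.Maybe using (Maybe; just; nothing)
import Data.Maybe.Properties as Maybe
open import Data.Maybe.Relation.Binary.Connected using (Connected; just)
open import Data.Product using (Σ; ∃₂; _×_; _,_; proj₁; proj₂)
open import Data.Sum using (_⊎_; inj₁; inj₂; [_,_]′)
import Data.Sum as Sum
open import Data.Unit using (⊤; tt)
open import Data.Empty using (⊥-elim)
open import Relation.Nullary using (¬_; Dec; yes; no; ¬?; contradiction)
import Relation.Nullary.Decidable as Dec
open import Relation.Nullary.Decidable using (_×-dec_; _⊎-dec_; toWitness)
open import Relation.Binary.Definitions using (DecidableEquality)
open import Relation.Binary.PropositionalEquality hiding ([_])
open import Relation.Unary using (Pred; _∪_; _⊆_; _≐_; _⊥_)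
open import Relation.Unary.Properties using (≐-trans)
open import Function using (_∘_; id; case_of_)
open import Function.Bundles using (_⇔_; mk⇔)
open import Function.Definitions using (Injective)


module _ {A : Set} where

  head-++-∷ : ∀ (xs : List A) {y} ys zs → head (xs ++ y ∷ ys) ≡ head (xs ++ y ∷ zs)
  head-++-∷ []      ys zs = refl
  head-++-∷ (_ ∷ _) ys zs = refl

  last-++-∷ : ∀ (xs : List A) y ys → last (xs ++ y ∷ ys) ≡ last (y ∷ ys)
  last-++-∷ []           y ys = refl
  last-++-∷ (_ ∷ [])     y ys = refl
  last-++-∷ (_ ∷ x ∷ xs) y ys = last-++-∷ (x ∷ xs) y ys

  last-∷ʳ : ∀ (xs : List A) y → last (xs ++ [ y ]) ≡ just y
  last-∷ʳ xs y = last-++-∷ xs y []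

  unique-insert : ∀ (xs : List A) {ys zs} → Unique (xs ++ zs) → Unique ys →
                  Disjoint ys (xs ++ zs) → Unique (xs ++ ys ++ zs)
  unique-insert []       uzs uys dis = Unique.++⁺ uys uzs dis
  unique-insert (x ∷ xs) {ys} (x∉ ∷ u) uys dis =
    All.++⁺ (All.++⁻ˡ xs x∉) (All.++⁺ x∉ys (All.++⁻ʳ xs x∉)) ∷ unique-insert xs u uys (λ (p , q) → dis (p , there q))
    where
    x∉ys : All (λ y → ¬ x ≡ y) ys
    x∉ys = All.tabulate λ y∈ys x≡y → dis (subst (_∈ ys) (sym x≡y) y∈ys , here refl)

  unique-++⁻ : ∀ (xs : List A) {ys} → Unique (xs ++ ys) → Unique xs × Unique ys
  unique-++⁻ []       u         = [] , u
  unique-++⁻ (x ∷ xs) (x∉ ∷ u) with uxs , uys ← unique-++⁻ xs u = All.++⁻ˡ xs x∉ ∷ uxs , uys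

  unique-++-disjoint : ∀ (xs : List A) {ys} → Unique (xs ++ ys) → Disjoint xs ys
  unique-++-disjoint (x ∷ xs) (x∉ ∷ _) (here refl , v∈ys)  = All.lookup (All.++⁻ʳ xs x∉) v∈ys refl
  unique-++-disjoint (x ∷ xs) (_ ∷ u)  (there v∈xs , v∈ys) = unique-++-disjoint xs u (v∈xs , v∈ys)

  ∷ʳ-last : ∀ (xs : List A) {y} → last xs ≡ just y → Σ (List A) λ ys → xs ≡ ys ++ [ y ]
  ∷ʳ-last (x ∷ [])     refl = [] , refl
  ∷ʳ-last (x ∷ x′ ∷ xs) e with ys , eq ← ∷ʳ-last (x′ ∷ xs) e = x ∷ ys , cong (x ∷_) eq

  linked-++⁻ : ∀ {R : A → A → Set} (xs : List A) {ys} → Linked R (xs ++ ys) → Linked R xs × Linked R ys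
  linked-++⁻ []                l       = [] , l
  linked-++⁻ (x ∷ [])     {[]} l       = [-] , []
  linked-++⁻ (x ∷ [])  {_ ∷ _} (_ ∷ l) = [-] , l
  linked-++⁻ (x ∷ y ∷ xs)      (r ∷ l) with linked-++⁻ (y ∷ xs) l
  ... | l₁ , l₂ = r ∷ l₁ , l₂

  linked-consecutive : ∀ {R : A → A → Set} (xs : List A) {a b ys} → Linked R (xs ++ a ∷ b ∷ ys) → R a b
  linked-consecutive xs l with linked-++⁻ xs l
  ... | _ , (r ∷ _) = r

  Consecutive : A → A → List A → Set
  Consecutive p q L = ∃₂ λ xs ys → L ≡ xs ++ p ∷ q ∷ ys

  UsesEdge : A → A → List A → Set
  UsesEdge p q L = Consecutive p q L ⊎ Consecutive q p L

  UsesEdge-++ˡ : ∀ {p q} (L M : List A) → UsesEdge p q L → UsesEdge p q (L ++ M)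
  UsesEdge-++ˡ L M (inj₁ (xs , ys , refl)) = inj₁ (xs , ys ++ M , ++-assoc xs _ M)
  UsesEdge-++ˡ L M (inj₂ (xs , ys , refl)) = inj₂ (xs , ys ++ M , ++-assoc xs _ M)

  UsesEdge-++ʳ : ∀ {p q} (L M : List A) → UsesEdge p q M → UsesEdge p q (L ++ M)
  UsesEdge-++ʳ L M (inj₁ (xs , ys , refl)) = inj₁ (L ++ xs , ys , sym (++-assoc L xs _))
  UsesEdge-++ʳ L M (inj₂ (xs , ys , refl)) = inj₂ (L ++ xs , ys , sym (++-assoc L xs _))

  UsesEdge-insert : ∀ {p q a b} (xs ys M : List A) → UsesEdge p q M → UsesEdge p q (xs ++ a ∷ M ++ b ∷ ys)
  UsesEdge-insert {a = a} {b} xs ys M e = UsesEdge-++ʳ xs _ (UsesEdge-++ʳ [ a ] _ (UsesEdge-++ˡ M (b ∷ ys) e))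

  module _ (_≟_ : DecidableEquality A) where

    private
      consecutive-∷ : ∀ {p q u v L} → ((u ≡ p × v ≡ q) ⊎ Consecutive p q (v ∷ L)) ⇔ Consecutive p q (u ∷ v ∷ L)
      consecutive-∷ {u = u} = mk⇔
        (λ { (inj₁ (refl , refl)) → [] , _ , refl ; (inj₂ (xs , ys , eq)) → u ∷ xs , ys , cong (u ∷_) eq })
        (λ { ([] , ys , refl) → inj₁ (refl , refl) ; (_ ∷ xs , ys , eq) → inj₂ (xs , ys , ∷-injectiveʳ eq) })

    consecutive? : ∀ p q L → Dec (Consecutive p q L)
    consecutive? p q []          = no λ { ([] , _ , ()) ; (_ ∷ _ , _ , ()) }
    consecutive? p q (u ∷ [])    = no λ { ([] , _ , ()) ; (_ ∷ [] , _ , ()) ; (_ ∷ _ ∷ _ , _ , ()) }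
    consecutive? p q (u ∷ v ∷ L) = Dec.map consecutive-∷ (((u ≟ p) ×-dec (v ≟ q)) ⊎-dec consecutive? p q (v ∷ L))

    usesEdge? : ∀ p q L → Dec (UsesEdge p q L)
    usesEdge? p q L = consecutive? p q L ⊎-dec consecutive? q p L

  DetourableStart : A → A → List A → Set
  DetourableStart p q L = Σ A λ a → Σ A λ b → Σ (List A) λ zs →
    L ≡ a ∷ b ∷ zs × (∀ M → UsesEdge p q (a ∷ M ++ b ∷ zs))

  private
    consecutive-after-detour : ∀ {y p q} xs ys → head (xs ++ p ∷ q ∷ ys) ≡ just y → y ≢ p →
      Σ A λ a → Σ A λ b → Σ (List A) λ zs →
      xs ++ p ∷ q ∷ ys ≡ a ∷ b ∷ zs × (∀ M → Consecutive p q (a ∷ M ++ b ∷ zs))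
    consecutive-after-detour []           ys refl y≢p = ⊥-elim (y≢p refl)
    consecutive-after-detour (a ∷ [])     ys _    _   = a , _ , _ , refl , λ M → a ∷ M , ys , refl
    consecutive-after-detour (a ∷ b ∷ xs) ys _    _   =
      a , b , _ , refl , λ M → a ∷ M ++ b ∷ xs , ys , cong (a ∷_) (sym (++-assoc M (b ∷ xs) _))

  detourableStart : ∀ {y p q} (L : List A) → UsesEdge p q L → head L ≡ just y → y ≢ p → y ≢ q →
                    DetourableStart p q L
  detourableStart L (inj₁ (xs , ys , refl)) hd y≢p _ with consecutive-after-detour xs ys hd y≢p
  ... | a , b , zs , eq , c = a , b , zs , eq , λ M → inj₁ (c M)
  detourableStart L (inj₂ (xs , ys , refl)) hd _ y≢q with consecutive-after-detour xs ys hd y≢q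
  ... | a , b , zs , eq , c = a , b , zs , eq , λ M → inj₂ (c M)

UsesEdge-map : ∀ {A B : Set} (f : A → B) {p q} L → UsesEdge p q L → UsesEdge (f p) (f q) (map f L)
UsesEdge-map f L (inj₁ (xs , ys , refl)) = inj₁ (map f xs , map f ys , map-++ f xs _)
UsesEdge-map f L (inj₂ (xs , ys , refl)) = inj₂ (map f xs , map f ys , map-++ f xs _)

module HamiltonianPaths {A : Set} (_~_ : A → A → Set) where

  record HamPath (S : Pred A _) (a b : A) (L : List A) : Set where
    field
      starts : head L ≡ just a
      ends   : last L ≡ just b
      unique : Unique L
      linked : Linked _~_ L
      within : (_∈ L) ⊆ S
      covers : S ⊆ (_∈ L)

  open HamPath

  HamPath-cong : ∀ {S T a b L} → S ≐ T → HamPath S a b L → HamPath T a b L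
  HamPath-cong (S⊆T , T⊆S) h = record
    { starts = starts h ; ends = ends h ; unique = unique h ; linked = linked h
    ; within = S⊆T ∘ within h ; covers = covers h ∘ T⊆S }

  HamPath-++ : ∀ {S T a b c d} (M N : List A) → HamPath S a b M → HamPath T c d N →
               S ⊥ T → b ~ c → HamPath (S ∪ T) a d (M ++ N)
  HamPath-++ {c = c} {d} M N hm hn S⊥T b~c = record
    { starts = starts-++ M (starts hm)
    ; ends   = ends-++ N (ends hn) (starts hn)
    ; unique = Unique.++⁺ (unique hm) (unique hn) λ (z∈M , z∈N) → S⊥T (within hm z∈M , within hn z∈N)
    ; linked = Linked.++⁺ (linked hm) (subst₂ (Connected _~_) (sym (ends hm)) (sym (starts hn)) (just b~c)) (linked hn)
    ; within = λ z∈ → Sum.map (within hm) (within hn) (∈-++⁻ M z∈)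
    ; covers = [ ∈-++⁺ˡ ∘ covers hm , ∈-++⁺ʳ M ∘ covers hn ]′
    }
    where
    starts-++ : ∀ {a} M′ → head M′ ≡ just a → head (M′ ++ N) ≡ just a
    starts-++ (_ ∷ _) e = e
    ends-++ : ∀ N′ → last N′ ≡ just d → head N′ ≡ just c → last (M ++ N′) ≡ just d
    ends-++ (_ ∷ N′) e refl = trans (last-++-∷ M c N′) e

  HamPath-insert : ∀ {S T a b p q p′ q′} (xs ys M : List A) →
                   HamPath S a b (xs ++ p ∷ q ∷ ys) → HamPath T p′ q′ M →
                   S ⊥ T → p ~ p′ → q′ ~ q → HamPath (S ∪ T) a b (xs ++ p ∷ M ++ q ∷ ys)
  HamPath-insert {S} {T} {a} {b} {p} {q} {p′} {q′} xs ys M h m S⊥T p~p′ q′~q = record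
    { starts = trans (head-++-∷ xs (M ++ Z) Z) (starts h)
    ; ends   = trans (last-around M) (trans (sym (last-around [])) (ends h))
    ; unique = subst Unique XMZ≡ (unique-insert X (subst Unique (sym XZ≡) (unique h)) (unique m)
                 λ (z∈M , z∈XZ) → S⊥T (within h (subst (_ ∈_) XZ≡ z∈XZ) , within m z∈M))
    ; linked = subst (Linked _~_) XMZ≡ (linked-XMZ (linked-++⁻ X (subst (Linked _~_) (sym XZ≡) (linked h))))
    ; within = within-XMZ ∘ ∈-++⁻ X ∘ subst (_ ∈_) (sym XMZ≡)
    ; covers = [ covers-S ∘ ∈-++⁻ X ∘ subst (_ ∈_) (sym XZ≡) ∘ covers h
               , subst (_ ∈_) XMZ≡ ∘ ∈-++⁺ʳ X ∘ ∈-++⁺ˡ ∘ covers m ]′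
    }
    where
    X = xs ++ [ p ]
    Z = q ∷ ys
    XZ≡ : X ++ Z ≡ xs ++ p ∷ q ∷ ys
    XZ≡ = ++-assoc xs [ p ] Z
    XMZ≡ : X ++ M ++ Z ≡ xs ++ p ∷ M ++ Z
    XMZ≡ = ++-assoc xs [ p ] (M ++ Z)
    last-around : ∀ zs → last (xs ++ p ∷ zs ++ Z) ≡ last Z
    last-around zs = trans (cong last (sym (++-assoc xs (p ∷ zs) Z))) (last-++-∷ (xs ++ p ∷ zs) q ys)
    linked-XMZ : Linked _~_ X × Linked _~_ Z → Linked _~_ (X ++ M ++ Z)
    linked-XMZ (lX , lZ) = Linked.++⁺ lX (subst (λ e → Connected _~_ e (head (M ++ Z))) (sym (last-∷ʳ xs p)) (into M (starts m)))
                             (Linked.++⁺ (linked m) (subst (λ e → Connected _~_ e (just q)) (sym (ends m)) (just q′~q)) lZ)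
      where
      into : ∀ M′ → head M′ ≡ just p′ → Connected _~_ (just p) (head (M′ ++ Z))
      into (_ ∷ _) refl = just p~p′
    inS : ∀ {z} → z ∈ X ++ Z → S z
    inS = within h ∘ subst (_ ∈_) XZ≡
    within-XMZ : ∀ {z} → z ∈ X ⊎ z ∈ M ++ Z → (S ∪ T) z
    within-XMZ (inj₁ z∈X) = inj₁ (inS (∈-++⁺ˡ z∈X))
    within-XMZ (inj₂ z∈MZ) with ∈-++⁻ M z∈MZ
    ... | inj₁ z∈M = inj₂ (within m z∈M)
    ... | inj₂ z∈Z = inj₁ (inS (∈-++⁺ʳ X z∈Z))
    covers-S : ∀ {z} → z ∈ X ⊎ z ∈ Z → z ∈ xs ++ p ∷ M ++ Z
    covers-S (inj₁ z∈X) = subst (_ ∈_) XMZ≡ (∈-++⁺ˡ z∈X)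
    covers-S (inj₂ z∈Z) = subst (_ ∈_) XMZ≡ (∈-++⁺ʳ X (∈-++⁺ʳ M z∈Z))

  HamPath-close : ∀ {S u v} vs → HamPath S v u (v ∷ vs) → u ~ v →
                  Linked _~_ (v ∷ vs ++ [ v ]) × Σ (List A) λ ys → v ∷ vs ++ [ v ] ≡ ys ++ u ∷ v ∷ []
  HamPath-close {u = u} {v} vs h u~v with ys , L≡ ← ∷ʳ-last (v ∷ vs) (ends h) =
    Linked.++⁺ (linked h) (subst (λ e → Connected _~_ e (just v)) (sym (ends h)) (just u~v)) [-] ,
    ys , trans (cong (_++ [ v ]) L≡) (++-assoc ys [ u ] [ v ])

module Network (m : ℕ) where

  N : ℕ
  N = suc (suc (suc (suc (suc m))))

  Pos : Set
  Pos = Fin N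

  Word : Set
  Word = Vec (Fin N) N

  -- Positions are 0-based: pos₀ and pos₁ hold the paper's x₁ and x₂.
  pos₀ pos₁ pos₂ pos₃ : Pos
  pos₀ = zero
  pos₁ = suc zero
  pos₂ = suc (suc zero)
  pos₃ = suc (suc (suc zero))

  Outer : Pos → Set
  Outer c = 2 ℕ.≤ toℕ c

  outer≢pos₀ : ∀ {c} → Outer c → c ≢ pos₀
  outer≢pos₀ () refl

  outer≢pos₁ : ∀ {c} → Outer c → c ≢ pos₁
  outer≢pos₁ (s≤s ()) refl

  by-position : (P : Pos → Set) → P pos₀ → P pos₁ → (∀ j → Outer j → P j) → ∀ p → P p
  by-position P p₀ p₁ pₒ zero          = p₀
  by-position P p₀ p₁ pₒ (suc zero)    = p₁
  by-position P p₀ p₁ pₒ (suc (suc j)) = pₒ (suc (suc j)) (s≤s (s≤s z≤n))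

  infixl 6 _·_
  _·_ : Word → (Pos → Pos) → Word
  x · π = tabulate (lookup x ∘ π)

  lookup-· : ∀ (x : Word) π p → lookup (x · π) p ≡ lookup x (π p)
  lookup-· x π = VP.lookup∘tabulate (lookup x ∘ π)

  Word-ext : ∀ {x y : Word} → (∀ p → lookup x p ≡ lookup y p) → x ≡ y
  Word-ext {x} {y} h = trans (sym (VP.tabulate∘lookup x)) (trans (VP.tabulate-cong h) (VP.tabulate∘lookup y))

  ·-cong : ∀ (x : Word) {π ρ} → (∀ p → π p ≡ ρ p) → x · π ≡ x · ρ
  ·-cong x h = VP.tabulate-cong (cong (lookup x) ∘ h)

  ·-∘ : ∀ (x : Word) π ρ → (x · π) · ρ ≡ x · (π ∘ ρ)
  ·-∘ x π ρ = VP.tabulate-cong (lookup-· x π ∘ ρ)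

  ·-id : ∀ (x : Word) → x · id ≡ x
  ·-id = VP.tabulate∘lookup

  -- A record around IsPerm, so that x can be inferred from a proof of IsPermutation x.
  record IsPermutation (x : Word) : Set where
    constructor mkPerm
    field injective : IsPerm x

  lookup-injective : ∀ {x} → IsPermutation x → ∀ {a b} → lookup x a ≡ lookup x b → a ≡ b
  lookup-injective = IsPermutation.injective

  IsPermutation-· : ∀ {x π} → IsPermutation x → (∀ {p q} → π p ≡ π q → p ≡ q) → IsPermutation (x · π)
  IsPermutation-· {x} {π} px π-inj = mkPerm λ {p} {q} e →
    π-inj (lookup-injective px (trans (sym (lookup-· x π p)) (trans e (lookup-· x π q))))

  swap : Pos → Pos → Pos → Pos
  swap a b p with p FP.≟ a
  ... | yes _ = b
  ... | no _ with p FP.≟ b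
  ...   | yes _ = a
  ...   | no _  = p

  swap-left : ∀ a b → swap a b a ≡ b
  swap-left a b with a FP.≟ a
  ... | yes _  = refl
  ... | no a≢a = contradiction refl a≢a

  swap-right : ∀ a b → swap a b b ≡ a
  swap-right a b with b FP.≟ a
  ... | yes refl = refl
  ... | no _ with b FP.≟ b
  ...   | yes _  = refl
  ...   | no b≢b = contradiction refl b≢b

  swap-other : ∀ a b p → p ≢ a → p ≢ b → swap a b p ≡ p
  swap-other a b p p≢a p≢b with p FP.≟ a
  ... | yes p≡a = contradiction p≡a p≢a
  ... | no _ with p FP.≟ b
  ...   | yes p≡b = contradiction p≡b p≢b
  ...   | no _    = refl

  swap-involutive : ∀ a b p → swap a b (swap a b p) ≡ p
  swap-involutive a b p with p FP.≟ a
  ... | yes refl = swap-right p b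
  ... | no p≢a with p FP.≟ b
  ...   | yes refl = swap-left a p
  ...   | no p≢b   = swap-other a b p p≢a p≢b

  swap-injective : ∀ a b {p q} → swap a b p ≡ swap a b q → p ≡ q
  swap-injective a b {p} {q} e =
    trans (sym (swap-involutive a b p)) (trans (cong (swap a b) e) (swap-involutive a b q))

  swap₀ : Pos → Pos → Pos
  swap₀ = swap pos₀

  swap₀₁ : Pos → Pos
  swap₀₁ = swap₀ pos₁

  swap₀-pos₁ : ∀ {c} → Outer c → swap₀ c pos₁ ≡ pos₁
  swap₀-pos₁ {c} oc = swap-other pos₀ c pos₁ (λ ()) (outer≢pos₁ oc ∘ sym)

  swap₀-other : ∀ {c j} → Outer j → j ≢ c → swap₀ c j ≡ j
  swap₀-other {c} {j} oj = swap-other pos₀ c j (outer≢pos₀ oj)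

  swap₀₁-outer : ∀ {j} → Outer j → swap₀₁ j ≡ j
  swap₀₁-outer {j} oj = swap-other pos₀ pos₁ j (outer≢pos₀ oj) (outer≢pos₁ oj)

  -- The three adjacency rules as right actions: y = x · ⟦ g ⟧.
  data Generator : Set where
    rule-i   : Generator
    rule-ii  : (c : Pos) → Outer c → Generator
    rule-iii : (c : Pos) → Outer c → Generator

  ⟦_⟧ : Generator → Pos → Pos
  ⟦ rule-i ⟧         = swap₀₁
  ⟦ rule-ii c _ ⟧    = swap₀ c ∘ swap₀₁
  ⟦ rule-iii c _ ⟧   = swap₀₁ ∘ swap₀ c

  pivot : Generator → Pos
  pivot rule-i           = pos₁
  pivot (rule-ii c _)    = c
  pivot (rule-iii c _)   = c

  inverse : Generator → Generator
  inverse rule-i           = rule-i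
  inverse (rule-ii c oc)   = rule-iii c oc
  inverse (rule-iii c oc)  = rule-ii c oc

  ⟦⟧-inverse : ∀ g p → ⟦ g ⟧ (⟦ inverse g ⟧ p) ≡ p
  ⟦⟧-inverse rule-i         p = swap-involutive pos₀ pos₁ p
  ⟦⟧-inverse (rule-ii c _)  p = trans (cong (swap₀ c) (swap-involutive pos₀ pos₁ (swap₀ c p))) (swap-involutive pos₀ c p)
  ⟦⟧-inverse (rule-iii c _) p = trans (cong swap₀₁ (swap-involutive pos₀ c (swap₀₁ p))) (swap-involutive pos₀ pos₁ p)

  ⟦⟧-injective : ∀ g {p q} → ⟦ g ⟧ p ≡ ⟦ g ⟧ q → p ≡ q
  ⟦⟧-injective rule-i         = swap-injective pos₀ pos₁
  ⟦⟧-injective (rule-ii c _)  = swap-injective pos₀ pos₁ ∘ swap-injective pos₀ c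
  ⟦⟧-injective (rule-iii c _) = swap-injective pos₀ c ∘ swap-injective pos₀ pos₁

  ·⟦⟧-inverse : ∀ (x : Word) g → x · ⟦ g ⟧ · ⟦ inverse g ⟧ ≡ x
  ·⟦⟧-inverse x g = trans (·-∘ x ⟦ g ⟧ ⟦ inverse g ⟧) (trans (·-cong x (⟦⟧-inverse g)) (·-id x))

  ⟦⟧-fixes : ∀ g {j} → Outer j → j ≢ pivot g → ⟦ g ⟧ j ≡ j
  ⟦⟧-fixes rule-i         oj _   = swap₀₁-outer oj
  ⟦⟧-fixes (rule-ii c _)  oj j≢c = trans (cong (swap₀ c) (swap₀₁-outer oj)) (swap₀-other oj j≢c)
  ⟦⟧-fixes (rule-iii c _) oj j≢c = trans (cong swap₀₁ (swap₀-other oj j≢c)) (swap₀₁-outer oj)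

  ii-pos₀ : ∀ {c} oc → ⟦ rule-ii c oc ⟧ pos₀ ≡ pos₁
  ii-pos₀ = swap₀-pos₁

  ii-pivot : ∀ {c} oc → ⟦ rule-ii c oc ⟧ c ≡ pos₀
  ii-pivot {c} oc = trans (cong (swap₀ c) (swap₀₁-outer oc)) (swap-right pos₀ c)

  iii-pos₀ : ∀ {c} oc → ⟦ rule-iii c oc ⟧ pos₀ ≡ c
  iii-pos₀ = swap₀₁-outer

  iii-pos₁ : ∀ {c} oc → ⟦ rule-iii c oc ⟧ pos₁ ≡ pos₀
  iii-pos₁ oc = cong swap₀₁ (swap₀-pos₁ oc)

  iii-pivot : ∀ {c} oc → ⟦ rule-iii c oc ⟧ c ≡ pos₁
  iii-pivot {c} _ = cong swap₀₁ (swap-right pos₀ c)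

  ⟦⟧-pivot : ∀ g → ⟦ g ⟧ (pivot g) ≡ pos₀ ⊎ ⟦ g ⟧ (pivot g) ≡ pos₁
  ⟦⟧-pivot rule-i            = inj₁ refl
  ⟦⟧-pivot (rule-ii c oc)    = inj₁ (ii-pivot oc)
  ⟦⟧-pivot (rule-iii c oc)   = inj₂ (iii-pivot oc)

  ⟦⟧-moves-pos₀ : ∀ g → ⟦ g ⟧ pos₀ ≢ pos₀
  ⟦⟧-moves-pos₀ rule-i ()
  ⟦⟧-moves-pos₀ (rule-ii c oc) e with () ← trans (sym (ii-pos₀ oc)) e
  ⟦⟧-moves-pos₀ (rule-iii c oc) e = outer≢pos₀ oc (trans (sym (iii-pos₀ oc)) e)

  iii∘iii≗ii∘ii : ∀ {c t} (oc : Outer c) (ot : Outer t) → c ≢ t → ∀ p →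
                  ⟦ rule-iii t ot ⟧ (⟦ rule-iii c oc ⟧ p) ≡ ⟦ rule-ii c oc ⟧ (⟦ rule-ii t ot ⟧ p)
  iii∘iii≗ii∘ii {c} {t} oc ot c≢t = by-position _
    (trans (cong ⟦ rule-iii t ot ⟧ (iii-pos₀ oc)) (trans (⟦⟧-fixes (rule-iii t ot) oc c≢t)
      (sym (cong ⟦ rule-ii c oc ⟧ (ii-pos₀ ot)))))
    (trans (cong ⟦ rule-iii t ot ⟧ (iii-pos₁ oc)) (trans (iii-pos₀ ot)
      (sym (⟦⟧-fixes (rule-ii c oc) ot (c≢t ∘ sym)))))
    outer
    where
    outer : ∀ j → Outer j → ⟦ rule-iii t ot ⟧ (⟦ rule-iii c oc ⟧ j) ≡ ⟦ rule-ii c oc ⟧ (⟦ rule-ii t ot ⟧ j)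
    outer j oj with j FP.≟ c | j FP.≟ t
    ... | yes refl | _ = trans (cong ⟦ rule-iii t ot ⟧ (iii-pivot oc)) (trans (iii-pos₁ ot)
                           (sym (trans (cong ⟦ rule-ii c oc ⟧ (⟦⟧-fixes (rule-ii t ot) oj c≢t)) (ii-pivot oc))))
    ... | no _ | yes refl =
      trans (cong ⟦ rule-iii t ot ⟧ (⟦⟧-fixes (rule-iii c oc) oj (c≢t ∘ sym))) (trans (iii-pivot ot)
        (sym (trans (cong ⟦ rule-ii c oc ⟧ (ii-pivot ot)) (ii-pos₀ oc))))
    ... | no j≢c | no j≢t =
      trans (cong ⟦ rule-iii t ot ⟧ (⟦⟧-fixes (rule-iii c oc) oj j≢c)) (trans (⟦⟧-fixes (rule-iii t ot) oj j≢t)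
        (sym (trans (cong ⟦ rule-ii c oc ⟧ (⟦⟧-fixes (rule-ii t ot) oj j≢t)) (⟦⟧-fixes (rule-ii c oc) oj j≢c))))

  lookup-·⟦⟧ : ∀ (x : Word) g p {q} → ⟦ g ⟧ p ≡ q → lookup (x · ⟦ g ⟧) p ≡ lookup x q
  lookup-·⟦⟧ x g p e = trans (lookup-· x ⟦ g ⟧ p) (cong (lookup x) e)

  at-pos₀₁ : (P : Pos → Pos → Set) → P pos₀ pos₁ → ∀ a b → toℕ a ≡ 0 → toℕ b ≡ 1 → P a b
  at-pos₀₁ P p zero (suc zero)    _ _ = p
  at-pos₀₁ P p zero zero          _ ()
  at-pos₀₁ P p zero (suc (suc _)) _ ()
  at-pos₀₁ P p (suc _) _          () _

  rule-·⟦⟧ : ∀ (x : Word) g → RuleI x (x · ⟦ g ⟧) ⊎ RuleII x (x · ⟦ g ⟧) ⊎ RuleIII x (x · ⟦ g ⟧)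
  rule-·⟦⟧ x g@rule-i = inj₁ (at-pos₀₁ _
    (lookup-·⟦⟧ x g pos₀ refl , lookup-·⟦⟧ x g pos₁ refl , λ j oj → lookup-·⟦⟧ x g j (swap₀₁-outer oj)))
  rule-·⟦⟧ x g@(rule-ii c oc) = inj₂ (inj₁ (c , oc , at-pos₀₁ _
    (lookup-·⟦⟧ x g pos₀ (ii-pos₀ oc) , lookup-·⟦⟧ x g pos₁ refl , lookup-·⟦⟧ x g c (ii-pivot oc) ,
     λ j oj j≢c → lookup-·⟦⟧ x g j (⟦⟧-fixes g oj j≢c))))
  rule-·⟦⟧ x g@(rule-iii c oc) = inj₂ (inj₂ (c , oc , at-pos₀₁ _
    (lookup-·⟦⟧ x g pos₀ (iii-pos₀ oc) , lookup-·⟦⟧ x g pos₁ (iii-pos₁ oc) , lookup-·⟦⟧ x g c (iii-pivot oc) ,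
     λ j oj j≢c → lookup-·⟦⟧ x g j (⟦⟧-fixes g oj j≢c))))

  ≢-·⟦⟧ : ∀ {x} → IsPermutation x → ∀ g → x ≢ x · ⟦ g ⟧
  ≢-·⟦⟧ {x} px g e = ⟦⟧-moves-pos₀ g (sym (lookup-injective px (trans (cong (λ z → lookup z pos₀) e) (lookup-· x ⟦ g ⟧ pos₀))))

  Adj-·⟦⟧ : ∀ {x} → IsPermutation x → ∀ g → Adj x (x · ⟦ g ⟧)
  Adj-·⟦⟧ {x} px g = ≢-·⟦⟧ px g , rule-·⟦⟧ x g

  Adj⇒·⟦⟧ : ∀ {x y} → Adj x y → Σ Generator λ g → y ≡ x · ⟦ g ⟧
  Adj⇒·⟦⟧ {x} {y} (_ , inj₁ r) = rule-i , Word-ext (by-position _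
    (via y₀ refl) (via y₁ refl) λ j oj → via (yⱼ j oj) (swap₀₁-outer oj))
    where
    via : ∀ {p q} → lookup y p ≡ lookup x q → ⟦ rule-i ⟧ p ≡ q → lookup y p ≡ lookup (x · ⟦ rule-i ⟧) p
    via {p} e ep = trans e (sym (lookup-·⟦⟧ x rule-i p ep))
    y₀ = proj₁ (r pos₀ pos₁ refl refl)
    y₁ = proj₁ (proj₂ (r pos₀ pos₁ refl refl))
    yⱼ = proj₂ (proj₂ (r pos₀ pos₁ refl refl))
  Adj⇒·⟦⟧ {x} {y} (_ , inj₂ (inj₁ (c , oc , r))) = g , Word-ext (by-position _
    (via y₀ (ii-pos₀ oc)) (via y₁ refl) outer)
    where
    g = rule-ii c oc
    via : ∀ {p q} → lookup y p ≡ lookup x q → ⟦ g ⟧ p ≡ q → lookup y p ≡ lookup (x · ⟦ g ⟧) p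
    via {p} e ep = trans e (sym (lookup-·⟦⟧ x g p ep))
    y₀ = proj₁ (r pos₀ pos₁ refl refl)
    y₁ = proj₁ (proj₂ (r pos₀ pos₁ refl refl))
    y꜀ = proj₁ (proj₂ (proj₂ (r pos₀ pos₁ refl refl)))
    yⱼ = proj₂ (proj₂ (proj₂ (r pos₀ pos₁ refl refl)))
    outer : ∀ j → Outer j → lookup y j ≡ lookup (x · ⟦ g ⟧) j
    outer j oj with j FP.≟ c
    ... | yes refl = via y꜀ (ii-pivot oc)
    ... | no j≢c   = via (yⱼ j oj j≢c) (⟦⟧-fixes g oj j≢c)
  Adj⇒·⟦⟧ {x} {y} (_ , inj₂ (inj₂ (c , oc , r))) = g , Word-ext (by-position _
    (via y₀ (iii-pos₀ oc)) (via y₁ (iii-pos₁ oc)) outer)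
    where
    g = rule-iii c oc
    via : ∀ {p q} → lookup y p ≡ lookup x q → ⟦ g ⟧ p ≡ q → lookup y p ≡ lookup (x · ⟦ g ⟧) p
    via {p} e ep = trans e (sym (lookup-·⟦⟧ x g p ep))
    y₀ = proj₁ (r pos₀ pos₁ refl refl)
    y₁ = proj₁ (proj₂ (r pos₀ pos₁ refl refl))
    y꜀ = proj₁ (proj₂ (proj₂ (r pos₀ pos₁ refl refl)))
    yⱼ = proj₂ (proj₂ (proj₂ (r pos₀ pos₁ refl refl)))
    outer : ∀ j → Outer j → lookup y j ≡ lookup (x · ⟦ g ⟧) j
    outer j oj with j FP.≟ c
    ... | yes refl = via y꜀ (iii-pivot oc)
    ... | no j≢c   = via (yⱼ j oj j≢c) (⟦⟧-fixes g oj j≢c)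

  Adj-sym : ∀ {x y} → IsPermutation y → Adj x y → Adj y x
  Adj-sym {x} py a with Adj⇒·⟦⟧ a
  ... | g , refl = subst (Adj (x · ⟦ g ⟧)) (·⟦⟧-inverse x g) (Adj-·⟦⟧ py (inverse g))

  ·swap₀₁-twice : ∀ v → v · swap₀₁ · swap₀₁ ≡ v
  ·swap₀₁-twice v = ·⟦⟧-inverse v rule-i

  ·swap₀₁-transpose : ∀ {u v} → u · swap₀₁ ≡ v → u ≡ v · swap₀₁
  ·swap₀₁-transpose {u} e = trans (sym (·swap₀₁-twice u)) (cong (_· swap₀₁) e)

  ·swap₀₁-injective : ∀ {u v} → u · swap₀₁ ≡ v · swap₀₁ → u ≡ v
  ·swap₀₁-injective {v = v} e = trans (·swap₀₁-transpose e) (·swap₀₁-twice v)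

  IsPermutation-·⟦⟧ : ∀ {v} → IsPermutation v → ∀ g → IsPermutation (v · ⟦ g ⟧)
  IsPermutation-·⟦⟧ pv g = IsPermutation-· pv (⟦⟧-injective g)

  Adj-·swap₀₁⁻ : ∀ {v} → IsPermutation v → Adj (v · swap₀₁) v
  Adj-·swap₀₁⁻ {v} pv = subst (Adj (v · swap₀₁)) (·swap₀₁-twice v) (Adj-·⟦⟧ (IsPermutation-·⟦⟧ pv rule-i) rule-i)

  pos₀-·swap₀₁ : ∀ {v a} → IsPermutation v → lookup v pos₀ ≡ a → lookup (v · swap₀₁) pos₀ ≢ a
  pos₀-·swap₀₁ {v} pv v₀≡a e with () ← lookup-injective pv (trans v₀≡a (sym (trans (sym (lookup-· v swap₀₁ pos₀)) e)))

  ·swap₀₁-conjugate : ∀ x g → x · swap₀₁ · ⟦ inverse g ⟧ ≡ x · ⟦ g ⟧ · swap₀₁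
  ·swap₀₁-conjugate x g = trans (·-∘ x swap₀₁ ⟦ inverse g ⟧) (trans (·-cong x (conjugate g)) (sym (·-∘ x ⟦ g ⟧ swap₀₁)))
    where
    conjugate : ∀ g p → swap₀₁ (⟦ inverse g ⟧ p) ≡ ⟦ g ⟧ (swap₀₁ p)
    conjugate rule-i         p = refl
    conjugate (rule-ii c _)  p =
      trans (swap-involutive pos₀ pos₁ (swap₀ c p)) (cong (swap₀ c) (sym (swap-involutive pos₀ pos₁ p)))
    conjugate (rule-iii c _) p = refl

  Adj-·swap₀₁-·⟦⟧ : ∀ {x} → IsPermutation x → ∀ g → Adj (x · swap₀₁) (x · ⟦ g ⟧ · swap₀₁)
  Adj-·swap₀₁-·⟦⟧ {x} px g =
    subst (Adj (x · swap₀₁)) (·swap₀₁-conjugate x g) (Adj-·⟦⟧ (IsPermutation-·⟦⟧ px rule-i) (inverse g))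

  Adj-·swap₀₁ : ∀ {x y} → IsPermutation x → Adj x y → Adj (x · swap₀₁) (y · swap₀₁)
  Adj-·swap₀₁ px x~y with g , refl ← Adj⇒·⟦⟧ x~y = Adj-·swap₀₁-·⟦⟧ px g

module Levels (m : ℕ) where

  open Network m

  -- Level t w, the permutations agreeing with w beyond position t, is a copy of S_{t+1}^2.
  record Level (t : Pos) (w x : Word) : Set where
    constructor mkLevel
    field
      isPermutation : IsPermutation x
      agrees        : ∀ p → toℕ t ℕ.< toℕ p → lookup x p ≡ lookup w p

  open Level public

  Class : Pos → Word → Pos → Word → Set
  Class t w s x = Level t w x × lookup x t ≡ s

  Available : Pos → Word → Pos → Set
  Available t w s = Σ Pos λ q → toℕ q ℕ.≤ toℕ t × lookup w q ≡ s

  Level-refl : ∀ {t w} → IsPermutation w → Level t w w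
  Level-refl pw = mkLevel pw λ _ _ → refl

  Level-recentre : ∀ {t w x y} → Level t w x → Level t w y → Level t x y
  Level-recentre (mkLevel _ fx) (mkLevel py fy) = mkLevel py λ p t<p → trans (fy p t<p) (sym (fx p t<p))

  Level-trans : ∀ {t w x y} → Level t w x → Level t x y → Level t w y
  Level-trans (mkLevel _ fx) (mkLevel py fy) = mkLevel py λ p t<p → trans (fy p t<p) (fx p t<p)

  lookup-surjective : ∀ {w} → IsPermutation w → ∀ s → Σ Pos λ q → lookup w q ≡ s
  lookup-surjective {w} pw s with FP.any? (λ q → lookup w q FP.≟ s)
  ... | yes found = found
  ... | no none = contradiction (FP.injective⇒≤ punched-injective) ℕP.1+n≰n
    where
    s≢ : ∀ q → s ≢ lookup w q
    s≢ q e = none (q , sym e)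
    punched : Pos → Fin (ℕ.pred N)
    punched q = F.punchOut (s≢ q)
    punched-injective : ∀ {a b} → punched a ≡ punched b → a ≡ b
    punched-injective = lookup-injective pw ∘ FP.punchOut-injective (s≢ _) (s≢ _)

  ≤⊎> : ∀ (a b : ℕ) → a ℕ.≤ b ⊎ b ℕ.< a
  ≤⊎> a b with a ℕP.≤? b
  ... | yes a≤b = inj₁ a≤b
  ... | no a≰b  = inj₂ (ℕP.≰⇒> a≰b)

  Level-prefix : ∀ {t w x j q} → Level t w x → lookup x j ≡ lookup w q → toℕ j ℕ.≤ toℕ t → toℕ q ℕ.≤ toℕ t
  Level-prefix {t} {q = q} (mkLevel px fx) e j≤t with ≤⊎> (toℕ q) (toℕ t)
  ... | inj₁ q≤t = q≤t
  ... | inj₂ t<q = subst (λ z → toℕ z ℕ.≤ toℕ t) (lookup-injective px (trans e (sym (fx q t<q)))) j≤t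

  Level-available : ∀ {t w x} → IsPermutation w → Level t w x → Available t w (lookup x t)
  Level-available {t} {x = x} pw lx with lookup-surjective pw (lookup x t)
  ... | q , e = q , Level-prefix lx (sym e) ℕP.≤-refl , e

  Available-recentre : ∀ {t w x s} → IsPermutation w → Level t w x → Available t w s → Available t x s
  Available-recentre {t} {w} {x} {s} pw lx (q , q≤t , e) with lookup-surjective (isPermutation lx) s
  ... | j , ej = j , Level-prefix (Level-recentre lx (Level-refl pw)) (trans e (sym ej)) q≤t , ej

  <⇒≢ : ∀ {a b : Pos} → toℕ a ℕ.< toℕ b → b ≢ a
  <⇒≢ a<b refl = ℕP.<-irrefl refl a<b

  ≤<⇒≢ : ∀ {a b c : Pos} → toℕ a ℕ.≤ toℕ c → toℕ c ℕ.< toℕ b → b ≢ a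
  ≤<⇒≢ a≤c c<b = <⇒≢ (ℕP.≤-<-trans a≤c c<b)

  outer-above : ∀ {t p : Pos} → 1 ℕ.≤ toℕ t → toℕ t ℕ.< toℕ p → Outer p
  outer-above 1≤t t<p = ℕP.≤-trans (s≤s 1≤t) t<p

  Level-·⟦⟧ : ∀ {t w x} → 1 ℕ.≤ toℕ t → Level t w x → ∀ g → toℕ (pivot g) ℕ.≤ toℕ t → Level t w (x · ⟦ g ⟧)
  Level-·⟦⟧ {t} {w} {x} 1≤t (mkLevel px fx) g g≤t = mkLevel (IsPermutation-· px (⟦⟧-injective g)) λ p t<p →
    trans (lookup-·⟦⟧ x g p (⟦⟧-fixes g (outer-above 1≤t t<p) (≤<⇒≢ g≤t t<p))) (fx p t<p)

  Level-pivot-≤ : ∀ {t w x} → 1 ℕ.≤ toℕ t → Level t w x → ∀ g → Level t w (x · ⟦ g ⟧) → toℕ (pivot g) ℕ.≤ toℕ t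
  Level-pivot-≤ {t} {w} {x} 1≤t (mkLevel px fx) g (mkLevel _ fy) with ≤⊎> (toℕ (pivot g)) (toℕ t)
  ... | inj₁ g≤t = g≤t
  ... | inj₂ t<g = contradiction (⟦⟧-pivot g) λ where
        (inj₁ e) → outer≢pos₀ og (trans g-fixes e)
        (inj₂ e) → outer≢pos₁ og (trans g-fixes e)
    where
    og = outer-above 1≤t t<g
    g-fixes : pivot g ≡ ⟦ g ⟧ (pivot g)
    g-fixes = lookup-injective px (sym (trans (sym (lookup-· x ⟦ g ⟧ (pivot g))) (trans (fy _ t<g) (sym (fx _ t<g)))))

  representative : ∀ {t w s} → IsPermutation w → Available t w s → Σ Word (Class t w s)
  representative {t} {w} pw (q , q≤t , e) = w · swap q t ,
    mkLevel (IsPermutation-· pw (swap-injective q t))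
      (λ p t<p → trans (lookup-· w (swap q t) p) (cong (lookup w) (swap-other q t p (≤<⇒≢ q≤t t<p) (<⇒≢ t<p)))) ,
    trans (lookup-· w (swap q t) t) (trans (cong (lookup w) (swap-right q t)) e)

  -- Each class of level t, seen from a member r, is level t′ = t - 1 of r.
  module Descend (t t′ : Pos) (t′+1≡t : suc (toℕ t′) ≡ toℕ t) where

    t′<t : toℕ t′ ℕ.< toℕ t
    t′<t = subst (toℕ t′ ℕ.<_) t′+1≡t ℕP.≤-refl

    ascend : ∀ {w s r x} → Class t w s r → Level t′ r x → Class t w s x
    ascend (mkLevel _ fr , rs) (mkLevel px fx) =
      mkLevel px (λ p t<p → trans (fx p (ℕP.<-trans t′<t t<p)) (fr p t<p)) , trans (fx t t′<t) rs

    descend : ∀ {w s r x} → Class t w s r → Class t w s x → Level t′ r x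
    descend {r = r} {x} (mkLevel _ fr , rs) (mkLevel px fx , xs) = mkLevel px agree
      where
      agree : ∀ p → toℕ t′ ℕ.< toℕ p → lookup x p ≡ lookup r p
      agree p t′<p with ℕP.m≤n⇒m<n∨m≡n (subst (ℕ._≤ toℕ p) t′+1≡t t′<p)
      ... | inj₁ t<p = trans (fx p t<p) (sym (fr p t<p))
      ... | inj₂ t≡p with refl ← FP.toℕ-injective t≡p = trans xs (sym rs)

module Chains (m : ℕ) where

  open Network m
  open Levels m
  open HamiltonianPaths (Adj {N})

  infix 4 _≟ʷ_
  _≟ʷ_ : (u v : Word) → Dec (u ≡ v)
  _≟ʷ_ = VP.≡-dec FP._≟_

  Apart : Word → Word → Word → Set
  Apart x y p = x ≢ p × x ≢ p · swap₀₁ × y ≢ p × y ≢ p · swap₀₁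

  HamPathThrough : Pos → Set
  HamPathThrough t = ∀ w x y p → Level t w x → Level t w y → Adj x y → Level t w p → Apart x y p →
    Σ (List Word) λ L → HamPath (Level t w) y x L × UsesEdge p (p · swap₀₁) L

  ≢-·swap₀₁ : ∀ {x p} → x ≢ p → x ≢ p · swap₀₁ → x · swap₀₁ ≢ p × x · swap₀₁ ≢ p · swap₀₁
  ≢-·swap₀₁ x≢p x≢p′ = x≢p′ ∘ ·swap₀₁-transpose , x≢p ∘ ·swap₀₁-injective

  OneOf : Word → Word × Word → Set
  OneOf z (a , b) = z ≡ a ⊎ z ≡ b

  apart-from : ∀ {x y z} → ¬ OneOf z (x , x · swap₀₁) → ¬ OneOf z (y , y · swap₀₁) → Apart x y z
  apart-from z∉x z∉y = (z∉x ∘ inj₁ ∘ sym) , (z∉x ∘ inj₂ ∘ ·swap₀₁-transpose ∘ sym) ,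
                       (z∉y ∘ inj₁ ∘ sym) , (z∉y ∘ inj₂ ∘ ·swap₀₁-transpose ∘ sym)

  σ : Fin 4 → Pos → Pos
  σ zero                   = id
  σ (suc zero)             = swap pos₁ pos₂
  σ (suc (suc zero))       = swap pos₁ pos₃
  σ (suc (suc (suc zero))) = swap pos₂ pos₃

  σ-injective : ∀ i {a b} → σ i a ≡ σ i b → a ≡ b
  σ-injective zero                   = id
  σ-injective (suc zero)             = swap-injective pos₁ pos₂
  σ-injective (suc (suc zero))       = swap-injective pos₁ pos₃
  σ-injective (suc (suc (suc zero))) = swap-injective pos₂ pos₃

  Fixes≥4 : (Pos → Pos) → Set
  Fixes≥4 π = ∀ q → π (suc (suc (suc (suc q)))) ≡ suc (suc (suc (suc q)))

  fixes≥4 : ∀ {π} → Fixes≥4 π → ∀ p → 4 ℕ.≤ toℕ p → π p ≡ p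
  fixes≥4 f (suc (suc (suc (suc q)))) _ = f q
  fixes≥4 f zero                    ()
  fixes≥4 f (suc zero)              (s≤s ())
  fixes≥4 f (suc (suc zero))        (s≤s (s≤s ()))
  fixes≥4 f (suc (suc (suc zero)))  (s≤s (s≤s (s≤s ())))

  σ-fixes : ∀ i → Fixes≥4 (σ i)
  σ-fixes zero                   _ = refl
  σ-fixes (suc zero)             _ = refl
  σ-fixes (suc (suc zero))       _ = refl
  σ-fixes (suc (suc (suc zero))) _ = refl

  σ-pos₀ : ∀ i → σ i pos₀ ≡ pos₀
  σ-pos₀ zero                   = refl
  σ-pos₀ (suc zero)             = refl
  σ-pos₀ (suc (suc zero))       = refl
  σ-pos₀ (suc (suc (suc zero))) = refl

  σ-separate : ∀ i k → i ≢ k → Σ Pos λ q → σ i q ≢ σ k q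
  σ-separate zero                   zero                   i≢k = contradiction refl i≢k
  σ-separate zero                   (suc zero)             _   = pos₁ , λ ()
  σ-separate zero                   (suc (suc zero))       _   = pos₁ , λ ()
  σ-separate zero                   (suc (suc (suc zero))) _   = pos₂ , λ ()
  σ-separate (suc zero)             zero                   _   = pos₁ , λ ()
  σ-separate (suc zero)             (suc zero)             i≢k = contradiction refl i≢k
  σ-separate (suc zero)             (suc (suc zero))       _   = pos₁ , λ ()
  σ-separate (suc zero)             (suc (suc (suc zero))) _   = pos₁ , λ ()
  σ-separate (suc (suc zero))       zero                   _   = pos₁ , λ ()
  σ-separate (suc (suc zero))       (suc zero)             _   = pos₁ , λ ()
  σ-separate (suc (suc zero))       (suc (suc zero))       i≢k = contradiction refl i≢k
  σ-separate (suc (suc zero))       (suc (suc (suc zero))) _   = pos₁ , λ ()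
  σ-separate (suc (suc (suc zero))) zero                   _   = pos₂ , λ ()
  σ-separate (suc (suc (suc zero))) (suc zero)             _   = pos₁ , λ ()
  σ-separate (suc (suc (suc zero))) (suc (suc zero))       _   = pos₁ , λ ()
  σ-separate (suc (suc (suc zero))) (suc (suc (suc zero))) i≢k = contradiction refl i≢k

  module Candidates (t : Pos) (4≤t : 4 ℕ.≤ toℕ t) (w : Word) where

    Starts : Pos → Pos → Word → Set
    Starts s a z = lookup z pos₀ ≡ a × lookup z t ≡ s

    module _ {s : Pos} {r : Word} (cr : Class t w s r) {j : Pos} (j<t : toℕ j ℕ.< toℕ t) where

      private
        π : Fin 4 → Pos → Pos
        π i = swap₀ j ∘ σ i

        z : Fin 4 → Word
        z i = r · π i

        π-fixes : ∀ i p → toℕ t ℕ.≤ toℕ p → π i p ≡ p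
        π-fixes i p t≤p = trans (cong (swap₀ j) (fixes≥4 {σ i} (σ-fixes i) p 4≤p))
                            (swap-other pos₀ j p (<⇒≢ (ℕP.≤-trans (s≤s z≤n) 4≤p)) (<⇒≢ (ℕP.<-≤-trans j<t t≤p)))
          where 4≤p = ℕP.≤-trans 4≤t t≤p

        z-class : ∀ i → Class t w s (z i)
        z-class i = mkLevel (IsPermutation-· (isPermutation (proj₁ cr)) (σ-injective i ∘ swap-injective pos₀ j))
                      (λ p t<p → trans (lookup-· r (π i) p)
                                   (trans (cong (lookup r) (π-fixes i p (ℕP.<⇒≤ t<p))) (agrees (proj₁ cr) p t<p))) ,
                    trans (lookup-· r (π i) t) (trans (cong (lookup r) (π-fixes i t ℕP.≤-refl)) (proj₂ cr))

        z-starts : ∀ i → Starts s (lookup r j) (z i)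
        z-starts i = trans (lookup-· r (π i) pos₀) (cong (lookup r ∘ swap₀ j) (σ-pos₀ i)) , proj₂ (z-class i)

        z-distinct : ∀ i k → i ≢ k → z i ≢ z k
        z-distinct i k i≢k e with q , σq≢ ← σ-separate i k i≢k =
          σq≢ (swap-injective pos₀ j (lookup-injective (isPermutation (proj₁ cr))
            (trans (sym (lookup-· r (π i) q)) (trans (cong (λ v → lookup v q) e) (lookup-· r (π k) q)))))

        blocked? : (pairs : Fin 3 → Word × Word) → ∀ i → Dec (Σ (Fin 3) λ k → OneOf (z i) (pairs k))
        blocked? pairs i = FP.any? λ k → (z i ≟ʷ proj₁ (pairs k)) ⊎-dec (z i ≟ʷ proj₂ (pairs k))

      -- The four words z i start with r_j and stay in the class of r; a pair can hold at most one
      -- of them, so three pairs cannot exclude all four.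
      candidate : (pairs : Fin 3 → Word × Word) →
                  (∀ k → ¬ (Starts s (lookup r j) (proj₁ (pairs k)) × Starts s (lookup r j) (proj₂ (pairs k)))) →
                  Σ Word λ z → Class t w s z × lookup z pos₀ ≡ lookup r j × (∀ k → ¬ OneOf z (pairs k))
      candidate pairs at-most-one with FP.all? (blocked? pairs)
      ... | no not-all with i , free ← FP.¬∀⟶∃¬ 4 _ (blocked? pairs) not-all =
        z i , z-class i , proj₁ (z-starts i) , λ k z∈ → free (k , z∈)
      ... | yes all with i , k , i<k , same ← FP.pigeonhole (ℕP.n<1+n 3) (proj₁ ∘ all) =
        ⊥-elim (clash (proj₂ (all i)) (subst (OneOf (z k) ∘ pairs) (sym same) (proj₂ (all k))))
        where
        i≢k : i ≢ k
        i≢k refl = ℕP.<-irrefl refl i<k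
        clash : ∀ {l} → OneOf (z i) (pairs l) → ¬ OneOf (z k) (pairs l)
        clash {l} (inj₁ a) (inj₁ b) = z-distinct i k i≢k (trans a (sym b))
        clash {l} (inj₂ a) (inj₂ b) = z-distinct i k i≢k (trans a (sym b))
        clash {l} (inj₁ a) (inj₂ b) = at-most-one l (subst (Starts s _) a (z-starts i) , subst (Starts s _) b (z-starts k))
        clash {l} (inj₂ a) (inj₁ b) = at-most-one l (subst (Starts s _) b (z-starts k) , subst (Starts s _) a (z-starts i))

  module Link (t : Pos) (ot : Outer t) (w : Word) where

    ii iii : Pos → Pos
    ii  = ⟦ rule-ii t ot ⟧
    iii = ⟦ rule-iii t ot ⟧

    1≤t : 1 ℕ.≤ toℕ t
    1≤t = ℕP.≤-trans (s≤s z≤n) ot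

    Class-·ii : ∀ {s z} → Class t w s z → Class t w (lookup z pos₀) (z · ii)
    Class-·ii {z = z} (lz , _) = Level-·⟦⟧ 1≤t lz (rule-ii t ot) ℕP.≤-refl , lookup-·⟦⟧ z (rule-ii t ot) t (ii-pivot ot)

    Class-·iii : ∀ {s z} → Class t w s z → Class t w (lookup z pos₁) (z · iii)
    Class-·iii {z = z} (lz , _) = Level-·⟦⟧ 1≤t lz (rule-iii t ot) ℕP.≤-refl , lookup-·⟦⟧ z (rule-iii t ot) t (iii-pivot ot)

    Class-·swap₀₁ : ∀ {s z} → Class t w s z → Class t w s (z · swap₀₁)
    Class-·swap₀₁ {z = z} (lz , zs) = Level-·⟦⟧ 1≤t lz rule-i 1≤t , trans (lookup-·⟦⟧ z rule-i t (swap₀₁-outer ot)) zs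

    Adj-square : ∀ {z} → IsPermutation z → Adj (z · swap₀₁) (z · ii · swap₀₁)
    Adj-square pz = Adj-·swap₀₁-·⟦⟧ pz (rule-ii t ot)

    Apart-·ii : ∀ {z p} → z ≢ p · iii → z ≢ p · swap₀₁ · iii →
                Apart (z · ii · swap₀₁) (z · ii) p × Apart (z · ii) (z · ii · swap₀₁) p
    Apart-·ii {z} {p} z≢p z≢p′ = (≢p′ ∘ ·swap₀₁-transpose , ≢p ∘ ·swap₀₁-injective , ≢p , ≢p′) ,
                                 (≢p , ≢p′ , ≢p′ ∘ ·swap₀₁-transpose , ≢p ∘ ·swap₀₁-injective)
      where
      ≢p : z · ii ≢ p
      ≢p e = z≢p (trans (sym (·⟦⟧-inverse z (rule-ii t ot))) (cong (_· iii) e))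
      ≢p′ : z · ii ≢ p · swap₀₁
      ≢p′ e = z≢p′ (trans (sym (·⟦⟧-inverse z (rule-ii t ot))) (cong (_· iii) e))

  lastOf : Pos → List Pos → Pos
  lastOf s []       = s
  lastOf s (c ∷ cs) = lastOf c cs

  lastOf-∷ʳ : ∀ s cs c → lastOf s (cs ++ [ c ]) ≡ c
  lastOf-∷ʳ s []       c = refl
  lastOf-∷ʳ s (d ∷ cs) c = lastOf-∷ʳ d cs c

  UsesRung : Maybe Word → List Word → Set
  UsesRung nothing  L = ⊤
  UsesRung (just p) L = UsesEdge p (p · swap₀₁) L

  UsesRung-insert : ∀ mp {a b} (xs ys M : List Word) → UsesRung mp M → UsesRung mp (xs ++ a ∷ M ++ b ∷ ys)
  UsesRung-insert nothing  xs ys M _ = tt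
  UsesRung-insert (just p) xs ys M e = UsesEdge-insert xs ys M e

  module Chaining (t t′ : Pos) (t′+1≡t : suc (toℕ t′) ≡ toℕ t) (4≤t : 4 ℕ.≤ toℕ t)
                  (IH : HamPathThrough t′) (w : Word) (pw : IsPermutation w) where

    ot : Outer t
    ot = ℕP.≤-trans (s≤s (s≤s z≤n)) 4≤t

    open Descend t t′ t′+1≡t
    open Link t ot w
    open Candidates t 4≤t w

    InClasses : List Pos → Word → Set
    InClasses cs z = Level t w z × lookup z t ∈ cs

    Class≐InClasses : ∀ {s} → Class t w s ≐ InClasses [ s ]
    Class≐InClasses = (λ (lz , e) → lz , here e) , λ { (lz , here e) → lz , e }

    InClasses-∷ : ∀ {s cs} → Class t w s ∪ InClasses cs ≐ InClasses (s ∷ cs)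
    InClasses-∷ = (λ { (inj₁ (lz , e)) → lz , here e ; (inj₂ (lz , c∈)) → lz , there c∈ })
                , (λ { (lz , here e) → inj₁ (lz , e) ; (lz , there c∈) → inj₂ (lz , c∈) })

    Requirement : Pos → List Pos → Word → Word → Maybe Word → Set
    Requirement s cs x y nothing  = ⊤
    Requirement s cs x y (just p) = Class t w (lastOf s cs) p × (cs ≡ [] → Apart x y p)

    ChainPath : List Pos → Word → Word → Maybe Word → Set
    ChainPath cs y x mp = Σ (List Word) λ L → HamPath (InClasses cs) y x L × UsesRung mp L

    classPath : ∀ {s} → Available t w s → ∀ {x y p} → Class t w s x → Class t w s y → Adj x y →
                Class t w s p → Apart x y p →
                Σ (List Word) λ L → HamPath (Class t w s) y x L × UsesEdge p (p · swap₀₁) L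
    classPath as cx cy x~y cp apart with r , cr ← representative pw as
      with L , h , e ← IH r _ _ _ (descend cr cx) (descend cr cy) x~y (descend cr cp) apart =
      L , HamPath-cong (ascend cr , descend cr) h , e

    Class-perm : ∀ {s z} → Class t w s z → IsPermutation z
    Class-perm = isPermutation ∘ proj₁

    ¬Starts-·swap₀₁ : ∀ {s a v} → IsPermutation v → ¬ (Starts s a v × Starts s a (v · swap₀₁))
    ¬Starts-·swap₀₁ pv ((e , _) , (e′ , _)) = pos₀-·swap₀₁ pv e e′

    ¬Starts-·iii : ∀ {s a p} → IsPermutation p → ¬ (Starts s a (p · iii) × Starts s a (p · swap₀₁ · iii))
    ¬Starts-·iii {p = p} pp ((_ , e) , (_ , e′)) with () ← lookup-injective pp
      (trans (sym (trans (lookup-·⟦⟧ (p · swap₀₁) (rule-iii t ot) t (iii-pivot ot)) (lookup-· p swap₀₁ pos₁))) (trans e′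
        (sym (trans (sym (lookup-·⟦⟧ p (rule-iii t ot) t (iii-pivot ot))) e))))

    positionOf : ∀ {s s₂ x} → s ≢ s₂ → Class t w s x → Available t w s₂ →
                 Σ Pos λ j → toℕ j ℕ.< toℕ t × lookup x j ≡ s₂
    positionOf {x = x} s≢s₂ (lx , xs) as₂ with j , j≤t , xj ← Available-recentre pw lx as₂
      with ℕP.m≤n⇒m<n∨m≡n j≤t
    ... | inj₁ j<t = j , j<t , xj
    ... | inj₂ j≡t with refl ← FP.toℕ-injective j≡t = contradiction (trans (sym xs) xj) s≢s₂

    forbidden : Word → Word → Maybe Word → Fin 3 → Word × Word
    forbidden x y mp       zero             = x , x · swap₀₁
    forbidden x y mp       (suc zero)       = y , y · swap₀₁
    forbidden x y nothing  (suc (suc zero)) = x , x · swap₀₁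
    forbidden x y (just p) (suc (suc zero)) = p · iii , p · swap₀₁ · iii

    forbidden-¬Starts : ∀ {s cs x y a} → IsPermutation x → IsPermutation y → ∀ mp → Requirement s cs x y mp →
                        ∀ k → ¬ (Starts s a (proj₁ (forbidden x y mp k)) × Starts s a (proj₂ (forbidden x y mp k)))
    forbidden-¬Starts px py mp       _        zero             = ¬Starts-·swap₀₁ px
    forbidden-¬Starts px py mp       _        (suc zero)       = ¬Starts-·swap₀₁ py
    forbidden-¬Starts px py nothing  _        (suc (suc zero)) = ¬Starts-·swap₀₁ px
    forbidden-¬Starts px py (just p) (cp , _) (suc (suc zero)) = ¬Starts-·iii (Class-perm cp)

    Requirement-·ii : ∀ {s s₂ cs x y z} mp → Requirement s (s₂ ∷ cs) x y mp → ¬ OneOf z (forbidden x y mp (suc (suc zero))) →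
                      Requirement s₂ cs (z · ii · swap₀₁) (z · ii) mp × Requirement s₂ cs (z · ii) (z · ii · swap₀₁) mp
    Requirement-·ii nothing  _        _  = tt , tt
    Requirement-·ii (just p) (cp , _) z∉ with apart , apart′ ← Apart-·ii (z∉ ∘ inj₁) (z∉ ∘ inj₂) =
      (cp , λ _ → apart) , (cp , λ _ → apart′)

    s-apart : ∀ {s cs} → All (s ≢_) cs → Class t w s ⊥ InClasses cs
    s-apart s∉ ((_ , zs) , (_ , z∈)) = All.lookup s∉ (subst (_∈ _) zs z∈) refl

    ChainFrom : Pos → List Pos → Maybe Word → Set
    ChainFrom s cs mp = ∀ {x y} → Class t w s x → Class t w s y → Adj x y → Requirement s cs x y mp → ChainPath (s ∷ cs) y x mp

    -- Replace the edge z — z·swap₀₁ of a path through class s by the square through z·ii and z·ii·swap₀₁,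
    -- between which the chain of the remaining classes is inserted.
    detour : ∀ {s s₂ cs x y z} mp → All (s ≢_) (s₂ ∷ cs) → Class t w s z → Class t w s₂ (z · ii) →
             ¬ OneOf z (forbidden x y mp (suc (suc zero))) → Requirement s (s₂ ∷ cs) x y mp → ChainFrom s₂ cs mp →
             (L : List Word) → HamPath (Class t w s) y x L → UsesEdge z (z · swap₀₁) L →
             ChainPath (s ∷ s₂ ∷ cs) y x mp
    detour {s} {s₂} {cs} {x} {y} {z} mp s∉ cz cz′ z∉ req rest L h (inj₁ (xs , ys , refl))
      with M , hM , eM ← rest (Class-·swap₀₁ cz′) cz′ (Adj-·swap₀₁⁻ (Class-perm cz′)) (proj₁ (Requirement-·ii mp req z∉)) =
      xs ++ z ∷ M ++ z · swap₀₁ ∷ ys ,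
      HamPath-cong InClasses-∷ (HamPath-insert xs ys M h hM (s-apart s∉)
        (Adj-·⟦⟧ pz (rule-ii t ot)) (Adj-sym (Class-perm (Class-·swap₀₁ cz′)) (Adj-square pz))) ,
      UsesRung-insert mp xs ys M eM
      where pz = Class-perm cz
    detour {s} {s₂} {cs} {x} {y} {z} mp s∉ cz cz′ z∉ req rest L h (inj₂ (xs , ys , refl))
      with M , hM , eM ← rest cz′ (Class-·swap₀₁ cz′) (Adj-·⟦⟧ (Class-perm cz′) rule-i) (proj₂ (Requirement-·ii mp req z∉)) =
      xs ++ z · swap₀₁ ∷ M ++ z ∷ ys ,
      HamPath-cong InClasses-∷ (HamPath-insert xs ys M h hM (s-apart s∉)
        (Adj-square pz) (Adj-sym (Class-perm cz′) (Adj-·⟦⟧ pz (rule-ii t ot)))) ,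
      UsesRung-insert mp xs ys M eM
      where pz = Class-perm cz

    extend-chain : ∀ {s s₂ cs} mp → All (s ≢_) (s₂ ∷ cs) → Available t w s → Available t w s₂ →
                   ChainFrom s₂ cs mp → ChainFrom s (s₂ ∷ cs) mp
    extend-chain mp s∉ as as₂ rest {x} {y} cx cy x~y req
      with j , j<t , xj ← positionOf (All.head s∉) cx as₂
      with z , cz , z₀ , z∉ ← candidate cx j<t (forbidden x y mp) (forbidden-¬Starts (Class-perm cx) (Class-perm cy) mp req)
      with L , h , e ← classPath as cx cy x~y cz (apart-from (z∉ zero) (z∉ (suc zero))) =
      detour mp s∉ cz (proj₁ (Class-·ii cz) , trans (proj₂ (Class-·ii cz)) (trans z₀ xj)) (z∉ (suc (suc zero))) req rest L h e

    chain : ∀ s cs → Unique (s ∷ cs) → All (Available t w) (s ∷ cs) → ∀ mp → ChainFrom s cs mp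
    chain s [] _ (as ∷ []) (just p) cx cy x~y (cp , apart)
      with L , h , e ← classPath as cx cy x~y cp (apart refl) = L , HamPath-cong Class≐InClasses h , e
    chain s [] _ (as ∷ []) nothing {x} {y} cx cy x~y tt
      with z , cz , _ , z∉ ← candidate cx (ℕP.≤-trans (s≤s z≤n) 4≤t) (forbidden x y nothing)
                               (forbidden-¬Starts {cs = []} (Class-perm cx) (Class-perm cy) nothing tt)
      with L , h , _ ← classPath as cx cy x~y cz (apart-from (z∉ zero) (z∉ (suc zero))) =
      L , HamPath-cong Class≐InClasses h , tt
    chain s (s₂ ∷ cs) (s∉ ∷ u) (as ∷ as₂ ∷ all) mp = extend-chain mp s∉ as as₂ (chain s₂ cs u (as₂ ∷ all) mp)

module Step (m : ℕ) where

  open Network m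
  open Levels m
  open Chains m
  open HamiltonianPaths (Adj {N})
  open DecMembership (FP._≟_ {N}) using (_∈?_)

  module Arrangement (t : Pos) (w : Word) where

    available? : ∀ s → Dec (Available t w s)
    available? s = FP.any? λ q → (toℕ q ℕP.≤? toℕ t) ×-dec (lookup w q FP.≟ s)

    middle? : ∀ fixed s → Dec (Available t w s × s ∉ fixed)
    middle? fixed s = available? s ×-dec ¬? (s ∈? fixed)

    -- Opaque, so that unification never unfolds the filter over allFin N.
    opaque
      middle : List Pos → List Pos
      middle fixed = filter (middle? fixed) (allFin N)

      middle-unique : ∀ fixed → Unique (middle fixed)
      middle-unique fixed = Unique.filter⁺ (middle? fixed) (Unique.allFin⁺ N)

      middle-available : ∀ fixed → All (Available t w) (middle fixed)
      middle-available fixed = All.map proj₁ (All.all-filter (middle? fixed) (allFin N))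

      middle-∉ : ∀ fixed {s} → s ∈ middle fixed → s ∉ fixed
      middle-∉ fixed s∈ = proj₂ (proj₂ (∈-filter⁻ (middle? fixed) s∈))

      ∈-middle : ∀ fixed {s} → Available t w s → s ∉ fixed → s ∈ middle fixed
      ∈-middle fixed {s} as s∉ = ∈-filter⁺ (middle? fixed) (∈-allFin s) (as , s∉)

    Enumerates : List Pos → Set
    Enumerates cs = Unique cs × All (Available t w) cs × (∀ {s} → Available t w s → s ∈ cs)

    arrange : List Pos → List Pos → List Pos
    arrange front back = front ++ middle (front ++ back) ++ back

    arrange-unique : ∀ front back → Unique (front ++ back) → Unique (arrange front back)
    arrange-unique front back u = unique-insert front u (middle-unique _) λ (s∈ , s∈fb) → middle-∉ _ s∈ s∈fb

    arrange-available : ∀ front back → All (Available t w) (front ++ back) → All (Available t w) (arrange front back)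
    arrange-available front back a = All.++⁺ (All.++⁻ˡ front a) (All.++⁺ (middle-available _) (All.++⁻ʳ front a))

    arrange-complete : ∀ front back {s} → Available t w s → s ∈ arrange front back
    arrange-complete front back {s} as with s ∈? front ++ back
    ... | no s∉ = ∈-++⁺ʳ front (∈-++⁺ˡ (∈-middle _ as s∉))
    ... | yes s∈ with ∈-++⁻ front s∈
    ...   | inj₁ s∈front = ∈-++⁺ˡ s∈front
    ...   | inj₂ s∈back  = ∈-++⁺ʳ front (∈-++⁺ʳ _ s∈back)

    enumerates : ∀ front back → Unique (front ++ back) → All (Available t w) (front ++ back) → Enumerates (arrange front back)
    enumerates front back u a = arrange-unique front back u , arrange-available front back a , arrange-complete front back

  module Crossing (t : Pos) (ot : Outer t) (w : Word) where

    open Link t ot w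

    record CrossSquare (s : Pos) (a b : Word) : Set where
      field
        γ     : Pos
        a′ b′ : Word
        a′∈γ  : Class t w γ a′
        b′∈γ  : Class t w γ b′
        a~a′  : Adj a a′
        b′~b  : Adj b′ b
        b′~a′ : Adj b′ a′
        γ≢s   : γ ≢ s

    pivot≢t : ∀ {s a} g → Class t w s a → Class t w s (a · ⟦ g ⟧) → pivot g ≢ t
    pivot≢t {a = a} g (la , as) (_ , bs) refl with ⟦⟧-pivot g
    ... | inj₁ e = outer≢pos₀ ot (trans t≡g e)
      where t≡g = lookup-injective (isPermutation la) (trans as (trans (sym bs) (lookup-· a ⟦ g ⟧ t)))
    ... | inj₂ e = outer≢pos₁ ot (trans t≡g e)
      where t≡g = lookup-injective (isPermutation la) (trans as (trans (sym bs) (lookup-· a ⟦ g ⟧ t)))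

    -- For b = a·⟦rule-ii c⟧ the square a — a·iii — b·ii — b closes because iii∘⟦iii c⟧ = ⟦ii c⟧∘ii.
    square-ii : ∀ {s a b c} (oc : Outer c) → c ≢ t → Class t w s a → Class t w s b → b ≡ a · ⟦ rule-ii c oc ⟧ →
                Class t w (lookup a pos₁) (a · iii) × Class t w (lookup a pos₁) (b · ii) × Adj (a · iii) (b · ii)
    square-ii {a = a} {c = c} oc c≢t ca cb refl =
      Class-·iii ca ,
      (proj₁ (Class-·ii cb) , trans (proj₂ (Class-·ii cb)) (lookup-·⟦⟧ a (rule-ii c oc) pos₀ (ii-pos₀ oc))) ,
      subst (Adj (a · iii)) ·iii·iii (Adj-·⟦⟧ (IsPermutation-·⟦⟧ (isPermutation (proj₁ ca)) (rule-iii t ot)) (rule-iii c oc))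
      where
      ·iii·iii : a · iii · ⟦ rule-iii c oc ⟧ ≡ a · ⟦ rule-ii c oc ⟧ · ii
      ·iii·iii = trans (·-∘ a iii ⟦ rule-iii c oc ⟧)
                   (trans (·-cong a (iii∘iii≗ii∘ii oc ot c≢t)) (sym (·-∘ a ⟦ rule-ii c oc ⟧ ii)))

    crossSquare : ∀ {s a b} → Class t w s a → Class t w s b → Adj a b → CrossSquare s a b
    crossSquare {s} {a} ca cb a~b with Adj⇒·⟦⟧ a~b
    ... | rule-i , refl = record
      { γ = lookup a pos₀ ; a′ = a · ii ; b′ = a · swap₀₁ · iii
      ; a′∈γ = Class-·ii ca
      ; b′∈γ = proj₁ (Class-·iii cb) , trans (proj₂ (Class-·iii cb)) (lookup-· a swap₀₁ pos₁)
      ; a~a′ = Adj-·⟦⟧ pa (rule-ii t ot)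
      ; b′~b = Adj-sym (IsPermutation-·⟦⟧ pb (rule-iii t ot)) (Adj-·⟦⟧ pb (rule-iii t ot))
      ; b′~a′ = subst (λ v → Adj v (a · ii)) (sym (·swap₀₁-conjugate a (rule-ii t ot)))
                  (Adj-·swap₀₁⁻ (IsPermutation-·⟦⟧ pa (rule-ii t ot)))
      ; γ≢s = λ a₀≡s → outer≢pos₀ ot (lookup-injective pa (trans (proj₂ ca) (sym a₀≡s)))
      }
      where pa = isPermutation (proj₁ ca) ; pb = isPermutation (proj₁ cb)
    ... | g@(rule-ii c oc) , refl with a′∈γ , b′∈γ , a′~b′ ← square-ii oc (pivot≢t g ca cb) ca cb refl = record
      { γ = lookup a pos₁ ; a′ = a · iii ; b′ = a · ⟦ g ⟧ · ii
      ; a′∈γ = a′∈γ ; b′∈γ = b′∈γ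
      ; a~a′ = Adj-·⟦⟧ pa (rule-iii t ot)
      ; b′~b = Adj-sym (IsPermutation-·⟦⟧ pb (rule-ii t ot)) (Adj-·⟦⟧ pb (rule-ii t ot))
      ; b′~a′ = Adj-sym (isPermutation (proj₁ b′∈γ)) a′~b′
      ; γ≢s = λ a₁≡s → outer≢pos₁ ot (lookup-injective pa (trans (proj₂ ca) (sym a₁≡s)))
      }
      where pa = isPermutation (proj₁ ca) ; pb = isPermutation (proj₁ cb)
    ... | g@(rule-iii c oc) , refl
      with b′∈γ , a′∈γ , b′~a′ ← square-ii oc (pivot≢t g ca cb) cb ca (sym (·⟦⟧-inverse a g)) = record
      { γ = lookup (a · ⟦ g ⟧) pos₁ ; a′ = a · ii ; b′ = a · ⟦ g ⟧ · iii
      ; a′∈γ = a′∈γ ; b′∈γ = b′∈γ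
      ; a~a′ = Adj-·⟦⟧ pa (rule-ii t ot)
      ; b′~b = Adj-sym (IsPermutation-·⟦⟧ pb (rule-iii t ot)) (Adj-·⟦⟧ pb (rule-iii t ot))
      ; b′~a′ = b′~a′
      ; γ≢s = λ b₁≡s → outer≢pos₁ ot (lookup-injective pb (trans (proj₂ cb) (sym b₁≡s)))
      }
      where pa = isPermutation (proj₁ ca) ; pb = isPermutation (proj₁ cb)

  module InductionStep (t t′ : Pos) (t′+1≡t : suc (toℕ t′) ≡ toℕ t) (4≤t : 4 ℕ.≤ toℕ t)
                       (IH : HamPathThrough t′) where

    module Centred (x : Word) (px : IsPermutation x) where

      open Chaining t t′ t′+1≡t 4≤t IH x px
      open Link t ot x
      open Crossing t ot x
      open Arrangement t x

      LevelPath : Word → Word → Set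
      LevelPath y p = Σ (List Word) λ L → HamPath (Level t x) y x L × UsesEdge p (p · swap₀₁) L

      sx : Pos
      sx = lookup x t

      cx : Class t x sx x
      cx = Level-refl px , refl

      available : ∀ {z} → Level t x z → Available t x (lookup z t)
      available = Level-available px

      Level≐ : ∀ {cs} → Enumerates cs → InClasses cs ≐ Level t x
      Level≐ (_ , _ , complete) = proj₁ , λ lz → lz , complete (available lz)

      through-square : ∀ {y a b zs} → HamPath (Class t x sx) y x (a ∷ b ∷ zs) → CrossSquare sx a b →
                       Σ (List Word) λ M → HamPath (Level t x) y x (a ∷ M ++ b ∷ zs)
      through-square {zs = zs} h
        record { γ = γ ; a′∈γ = a′∈γ ; b′∈γ = b′∈γ ; a~a′ = a~a′ ; b′~b = b′~b ; b′~a′ = b′~a′ ; γ≢s = γ≢s }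
        with enumerates (sx ∷ γ ∷ []) [] (((γ≢s ∘ sym) ∷ []) ∷ [] ∷ [])
               (available (Level-refl px) ∷ subst (Available t x) (proj₂ a′∈γ) (available (proj₁ a′∈γ)) ∷ [])
      ... | enum@(s∉ ∷ uγ , _ ∷ allγ , _) with M , hM , _ ← chain γ _ uγ allγ nothing b′∈γ a′∈γ b′~a′ tt =
        M , HamPath-cong (≐-trans InClasses-∷ (Level≐ enum)) (HamPath-insert [] zs M h hM (s-apart s∉) a~a′ b′~b)

      rung-in-class : ∀ {y p} → Class t x sx y → Adj x y → Class t x sx p → Apart x y p → LevelPath y p
      rung-in-class {y} {p} cy x~y cp apart@(_ , _ , y≢p , y≢p′) =
        let L , h , e = classPath (available (Level-refl px)) cx cy x~y cp apart
            a , b , zs , L≡ , keeps = detourableStart L e (HamPath.starts h) y≢p y≢p′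
            h′ = subst (HamPath (Class t x sx) y x) L≡ h
            M , hM = through-square h′ (crossSquare (HamPath.within h′ (here refl)) (HamPath.within h′ (there (here refl)))
                                                    (linked-consecutive [] (HamPath.linked h′)))
        in a ∷ M ++ b ∷ zs , hM , keeps M

      rung-elsewhere : ∀ {y p} → Class t x sx y → Adj x y → Level t x p → lookup p t ≢ sx → LevelPath y p
      rung-elsewhere {y} {p} cy x~y lp sp≢sx =
        let enum = enumerates (sx ∷ []) (lookup p t ∷ []) (((sp≢sx ∘ sym) ∷ []) ∷ [] ∷ [])
                     (available (Level-refl px) ∷ available lp ∷ [])
            R = middle (sx ∷ lookup p t ∷ [])
            M , hM , e = chain sx (R ++ [ lookup p t ]) (proj₁ enum) (proj₁ (proj₂ enum)) (just p) cx cy x~y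
                           (subst (λ s → Class t x s p) (sym (lastOf-∷ʳ sx R (lookup p t))) (lp , refl) ,
                            λ last≡[] → case List.++-conicalʳ R [ lookup p t ] last≡[] of λ ())
        in M , HamPath-cong (Level≐ enum) hM , e

      glue : ∀ A B {y p mb ma} → Enumerates (A ++ B) → Adj (y · swap₀₁) (x · swap₀₁) →
             (Unique A → All (Available t x) A → ChainPath A y (y · swap₀₁) mb) →
             (Unique B → All (Available t x) B → ChainPath B (x · swap₀₁) x ma) →
             (∀ M N → UsesRung mb M → UsesRung ma N → UsesEdge p (p · swap₀₁) (M ++ N)) → LevelPath y p
      glue A B (u , all , complete) ys~xs chainA chainB uses =
        let uA , uB = unique-++⁻ A u
            M , hM , eM = chainA uA (All.++⁻ˡ A all)
            N , hN , eN = chainB uB (All.++⁻ʳ A all)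
        in M ++ N , HamPath-cong split (HamPath-++ M N hM hN disjoint ys~xs) , uses M N eM eN
        where
        split : InClasses A ∪ InClasses B ≐ Level t x
        split = [ proj₁ , proj₁ ]′ , λ lz → Sum.map (lz ,_) (lz ,_) (∈-++⁻ A (complete (available lz)))
        disjoint : InClasses A ⊥ InClasses B
        disjoint ((_ , s∈A) , (_ , s∈B)) = unique-++-disjoint A u (s∈A , s∈B)

      module _ {y p} (ly : Level t x y) (x~y : Adj x y) (lp : Level t x p) (apart : Apart x y p) where

        private
          sy sp : Pos
          sy = lookup y t
          sp = lookup p t
          cy : Class t x sy y
          cy = ly , refl
          py = isPermutation ly
          as-x = available (Level-refl px)
          as-y = available ly
          ys~xs : Adj (y · swap₀₁) (x · swap₀₁)
          ys~xs = Adj-sym (IsPermutation-·⟦⟧ py rule-i) (Adj-·swap₀₁ px x~y)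
          apart-x : Apart x (x · swap₀₁) p
          apart-x = let x≢p , x≢p′ , _ = apart in x≢p , x≢p′ , ≢-·swap₀₁ x≢p x≢p′
          apart-y : Apart (y · swap₀₁) y p
          apart-y = let _ , _ , y≢p , y≢p′ = apart in proj₁ (≢-·swap₀₁ y≢p y≢p′) , proj₂ (≢-·swap₀₁ y≢p y≢p′) , y≢p , y≢p′

        -- The edge y·swap₀₁ — x·swap₀₁ joins a chain of classes from y to y·swap₀₁ to the class
        -- of x traversed from x·swap₀₁ to x; the class of p is placed last in its part.
        cross : sy ≢ sx → LevelPath y p
        cross sy≢sx with sp FP.≟ sx | sp FP.≟ sy
        ... | yes sp≡sx | _ =
          glue (sy ∷ middle (sy ∷ sx ∷ [])) [ sx ] (enumerates [ sy ] [ sx ] ((sy≢sx ∷ []) ∷ [] ∷ []) (as-y ∷ as-x ∷ [])) ys~xs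
            (λ u a → chain sy _ u a nothing (Class-·swap₀₁ cy) cy (Adj-·swap₀₁⁻ py) tt)
            (λ u a → chain sx [] u a (just p) cx (Class-·swap₀₁ cx) (Adj-·⟦⟧ px rule-i) ((lp , sp≡sx) , λ _ → apart-x))
            (λ M N _ e → UsesEdge-++ʳ M N e)
        ... | no _ | yes sp≡sy =
          glue [ sy ] (sx ∷ _) (enumerates (sy ∷ sx ∷ []) [] ((sy≢sx ∷ []) ∷ [] ∷ []) (as-y ∷ as-x ∷ [])) ys~xs
            (λ u a → chain sy [] u a (just p) (Class-·swap₀₁ cy) cy (Adj-·swap₀₁⁻ py) ((lp , sp≡sy) , λ _ → apart-y))
            (λ u a → chain sx _ u a nothing cx (Class-·swap₀₁ cx) (Adj-·⟦⟧ px rule-i) tt)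
            (λ M N e _ → UsesEdge-++ˡ M N e)
        ... | no sp≢sx | no sp≢sy =
          glue (sy ∷ R ++ [ sp ]) [ sx ]
            (subst Enumerates (sym (cong (sy ∷_) (List.++-assoc R [ sp ] [ sx ])))
              (enumerates [ sy ] (sp ∷ sx ∷ []) ((sp≢sy ∘ sym ∷ sy≢sx ∷ []) ∷ (sp≢sx ∷ []) ∷ [] ∷ [])
                (as-y ∷ available lp ∷ as-x ∷ [])))
            ys~xs
            (λ u a → chain sy _ u a (just p) (Class-·swap₀₁ cy) cy (Adj-·swap₀₁⁻ py)
                       (subst (λ s → Class t x s p) (sym (lastOf-∷ʳ sy R sp)) (lp , refl) ,
                        λ last≡[] → case List.++-conicalʳ R [ sp ] last≡[] of λ ()))
            (λ u a → chain sx [] u a nothing cx (Class-·swap₀₁ cx) (Adj-·⟦⟧ px rule-i) tt)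
            (λ M N e _ → UsesEdge-++ˡ M N e)
          where
          R = middle (sy ∷ sp ∷ sx ∷ [])

      core : ∀ {y p} → Level t x y → Adj x y → Level t x p → Apart x y p → LevelPath y p
      core {y} {p} ly x~y lp apart with lookup y t FP.≟ sx | lookup p t FP.≟ sx
      ... | no sy≢sx  | _          = cross ly x~y lp apart sy≢sx
      ... | yes sy≡sx | yes sp≡sx  = rung-in-class (ly , sy≡sx) x~y (lp , sp≡sx) apart
      ... | yes sy≡sx | no sp≢sx   = rung-elsewhere (ly , sy≡sx) x~y lp sp≢sx

    step : HamPathThrough t
    step w x y p lx ly x~y lp apart =
      let L , h , e = Centred.core x (isPermutation lx) (Level-recentre lx ly) x~y (Level-recentre lx lp) apart
      in L , HamPath-cong (Level-trans lx , Level-recentre lx) h , e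

module Base (m : ℕ) where

  open Network m
  open Levels m
  open Chains m
  open HamiltonianPaths (Adj {N})

  pattern g₀ = zero
  pattern g₁ = suc zero
  pattern g₂ = suc (suc zero)
  pattern g₃ = suc (suc (suc zero))
  pattern g₄ = suc (suc (suc (suc zero)))

  gen : Fin 5 → Generator
  gen g₀ = rule-i
  gen g₁ = rule-ii pos₂ (s≤s (s≤s z≤n))
  gen g₂ = rule-ii pos₃ (s≤s (s≤s z≤n))
  gen g₃ = rule-iii pos₂ (s≤s (s≤s z≤n))
  gen g₄ = rule-iii pos₃ (s≤s (s≤s z≤n))

  gen-fixes : ∀ k → Fixes≥4 ⟦ gen k ⟧
  gen-fixes g₀ _ = refl
  gen-fixes g₁ _ = refl
  gen-fixes g₂ _ = refl
  gen-fixes g₃ _ = refl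
  gen-fixes g₄ _ = refl

  as-gen : ∀ g → toℕ (pivot g) ℕ.≤ 3 → Σ (Fin 5) λ k → ∀ q → ⟦ g ⟧ q ≡ ⟦ gen k ⟧ q
  as-gen rule-i                                      _ = g₀ , λ _ → refl
  as-gen (rule-ii (suc (suc zero)) _)                _ = g₁ , λ _ → refl
  as-gen (rule-ii (suc (suc (suc zero))) _)          _ = g₂ , λ _ → refl
  as-gen (rule-iii (suc (suc zero)) _)               _ = g₃ , λ _ → refl
  as-gen (rule-iii (suc (suc (suc zero))) _)         _ = g₄ , λ _ → refl
  as-gen (rule-ii zero ())                           _
  as-gen (rule-ii (suc zero) (s≤s ()))               _
  as-gen (rule-ii (suc (suc (suc (suc _)))) _)       (s≤s (s≤s (s≤s ())))
  as-gen (rule-iii zero ())                          _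
  as-gen (rule-iii (suc zero) (s≤s ()))              _
  as-gen (rule-iii (suc (suc (suc (suc _)))) _)      (s≤s (s≤s (s≤s ())))

  -- A permutation of level pos₃ is determined by its values on the first four positions.
  Table : Set
  Table = Vec Pos 4

  _≟ᵗ_ : DecidableEquality Table
  _≟ᵗ_ = VP.≡-dec FP._≟_

  tab : (Pos → Pos) → Table
  tab π = π pos₀ Vec.∷ π pos₁ Vec.∷ π pos₂ Vec.∷ π pos₃ Vec.∷ Vec.[]

  extend : Table → Pos → Pos
  extend τ zero                       = lookup τ zero
  extend τ (suc zero)                 = lookup τ (suc zero)
  extend τ (suc (suc zero))           = lookup τ (suc (suc zero))
  extend τ (suc (suc (suc zero)))     = lookup τ (suc (suc (suc zero)))
  extend τ (suc (suc (suc (suc q))))  = suc (suc (suc (suc q)))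

  extend-tab : ∀ {π} → Fixes≥4 π → ∀ p → extend (tab π) p ≡ π p
  extend-tab f zero                      = refl
  extend-tab f (suc zero)                = refl
  extend-tab f (suc (suc zero))          = refl
  extend-tab f (suc (suc (suc zero)))    = refl
  extend-tab f (suc (suc (suc (suc q)))) = sym (f q)

  ·extend-tab : ∀ x {π} → Fixes≥4 π → x · extend (tab π) ≡ x · π
  ·extend-tab x {π} f = ·-cong x (extend-tab {π} f)

  small : Fin 4 → Pos
  small zero                   = pos₀
  small (suc zero)             = pos₁
  small (suc (suc zero))       = pos₂
  small (suc (suc (suc zero))) = pos₃

  ·extend-injective : ∀ {x} → IsPermutation x → ∀ {τ τ′} → x · extend τ ≡ x · extend τ′ → τ ≡ τ′
  ·extend-injective {x} px {τ} {τ′} e =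
    trans (sym (VP.tabulate∘lookup τ)) (trans (VP.tabulate-cong at) (VP.tabulate∘lookup τ′))
    where
    extend-at : ∀ σ i → extend σ (small i) ≡ lookup σ i
    extend-at σ zero                   = refl
    extend-at σ (suc zero)             = refl
    extend-at σ (suc (suc zero))       = refl
    extend-at σ (suc (suc (suc zero))) = refl
    at : ∀ i → lookup τ i ≡ lookup τ′ i
    at i = trans (sym (extend-at τ i)) (trans (lookup-injective px
             (trans (sym (lookup-· x (extend τ) p)) (trans (cong (λ v → lookup v p) e) (lookup-· x (extend τ′) p))))
             (extend-at τ′ i))
      where p = small i

  small≢ : ∀ a q → small a ≢ suc (suc (suc (suc q)))
  small≢ zero                   q ()
  small≢ (suc zero)             q ()
  small≢ (suc (suc zero))       q ()
  small≢ (suc (suc (suc zero))) q ()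

  swap-fixes≥4 : ∀ a b → Fixes≥4 (swap (small a) (small b))
  swap-fixes≥4 a b q = swap-other (small a) (small b) _ (small≢ a q ∘ sym) (small≢ b q ∘ sym)

  as-small : ∀ {k} (q : Pos) → toℕ q ℕ.≤ k → k ℕ.≤ 3 → Σ (Fin 4) λ a → small a ≡ q
  as-small zero                       _ _ = zero , refl
  as-small (suc zero)                 _ _ = suc zero , refl
  as-small (suc (suc zero))           _ _ = suc (suc zero) , refl
  as-small (suc (suc (suc zero)))     _ _ = suc (suc (suc zero)) , refl
  as-small (suc (suc (suc (suc q)))) q≤k k≤3 with s≤s (s≤s (s≤s ())) ← ℕP.≤-trans q≤k k≤3

  -- Peeling off positions 3, 2, 1 writes every member of level pos₃ of w as w · vertex a b c.
  vertex : Fin 4 → Fin 4 → Fin 4 → Pos → Pos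
  vertex a b c = swap (small a) pos₃ ∘ swap (small b) pos₂ ∘ swap (small c) pos₁

  vertex-fixes : ∀ a b c → Fixes≥4 (vertex a b c)
  vertex-fixes a b c q = trans (cong (swap (small a) pos₃ ∘ swap (small b) pos₂) (swap-fixes≥4 c (suc zero) q))
    (trans (cong (swap (small a) pos₃) (swap-fixes≥4 b (suc (suc zero)) q)) (swap-fixes≥4 a (suc (suc (suc zero))) q))

  -- Opaque, so that conversion checking never evaluates lookup-surjective.
  opaque
    peel : ∀ t t′ → suc (toℕ t′) ≡ toℕ t → ∀ {w z} → IsPermutation w → Level t w z →
           Σ Pos λ q → toℕ q ℕ.≤ toℕ t × Level t′ (w · swap q t) z
    peel t t′ t′+1≡t pw lz with q , q≤t , e ← Level-available pw lz =
      q , q≤t , Descend.descend t t′ t′+1≡t (proj₂ (representative pw (q , q≤t , e))) (lz , refl)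

  Level-pos₀ : ∀ {v z} → IsPermutation v → Level pos₀ v z → z ≡ v
  Level-pos₀ {v} {z} pv (mkLevel pz fz) = Word-ext agree
    where
    agree : ∀ p → lookup z p ≡ lookup v p
    agree (suc p) = fz (suc p) (s≤s z≤n)
    agree zero with lookup-surjective pv (lookup z pos₀)
    ... | zero  , e = sym e
    ... | suc q , e with () ← lookup-injective pz (trans (sym e) (sym (fz (suc q) (s≤s z≤n))))

  IsPermutation-·swap : ∀ {w} → IsPermutation w → ∀ q t → IsPermutation (w · swap q t)
  IsPermutation-·swap pw q t = IsPermutation-· pw (swap-injective q t)

  Level-pos₁ : ∀ {w z} → IsPermutation w → Level pos₁ w z → Σ (Fin 4) λ c → z ≡ w · swap (small c) pos₁
  Level-pos₁ {w} {z} pw l₁ =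
    let q , q≤1 , l₀ = peel pos₁ pos₀ refl pw l₁
        c , c≡q = as-small q q≤1 (s≤s z≤n)
    in c , subst (λ q → z ≡ w · swap q pos₁) (sym c≡q) (Level-pos₀ (IsPermutation-·swap pw q pos₁) l₀)

  Level-pos₂ : ∀ {w z} → IsPermutation w → Level pos₂ w z →
               Σ (Fin 4) λ b → Σ (Fin 4) λ c → z ≡ w · (swap (small b) pos₂ ∘ swap (small c) pos₁)
  Level-pos₂ {w} {z} pw l₂ =
    let q , q≤2 , l₁ = peel pos₂ pos₁ refl pw l₂
        b , b≡q = as-small q q≤2 (s≤s (s≤s z≤n))
        c , z≡ = Level-pos₁ (IsPermutation-·swap pw (small b) pos₂) (subst (λ q → Level pos₁ (w · swap q pos₂) z) (sym b≡q) l₁)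
    in b , c , trans z≡ (·-∘ w (swap (small b) pos₂) (swap (small c) pos₁))

  level-pos₃ : ∀ {w z} → IsPermutation w → Level pos₃ w z → Σ (Fin 4) λ a → Σ (Fin 4) λ b → Σ (Fin 4) λ c → z ≡ w · vertex a b c
  level-pos₃ {w} {z} pw l₃ =
    let q , q≤3 , l₂ = peel pos₃ pos₂ refl pw l₃
        a , a≡q = as-small q q≤3 ℕP.≤-refl
        b , c , z≡ = Level-pos₂ (IsPermutation-·swap pw (small a) pos₃)
                       (subst (λ q → Level pos₂ (w · swap q pos₃) z) (sym a≡q) l₂)
    in a , b , c , trans z≡ (·-∘ w (swap (small a) pos₃) (swap (small b) pos₂ ∘ swap (small c) pos₁))

  gen-table : Fin 5 → Vec (Fin 4) 4
  gen-table g₀ = suc zero Vec.∷ zero Vec.∷ suc (suc zero) Vec.∷ suc (suc (suc zero)) Vec.∷ Vec.[]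
  gen-table g₁ = suc zero Vec.∷ suc (suc zero) Vec.∷ zero Vec.∷ suc (suc (suc zero)) Vec.∷ Vec.[]
  gen-table g₂ = suc zero Vec.∷ suc (suc (suc zero)) Vec.∷ suc (suc zero) Vec.∷ zero Vec.∷ Vec.[]
  gen-table g₃ = suc (suc zero) Vec.∷ zero Vec.∷ suc zero Vec.∷ suc (suc (suc zero)) Vec.∷ Vec.[]
  gen-table g₄ = suc (suc (suc zero)) Vec.∷ zero Vec.∷ suc (suc zero) Vec.∷ suc zero Vec.∷ Vec.[]

  -- Computed through the literal gen-table, so that checking walks never evaluates swap.
  step : Table → Fin 5 → Table
  step τ k = Vec.map (lookup τ) (gen-table k)

  step-tab : ∀ τ k → step τ k ≡ tab (extend τ ∘ ⟦ gen k ⟧)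
  step-tab τ g₀ = refl
  step-tab τ g₁ = refl
  step-tab τ g₂ = refl
  step-tab τ g₃ = refl
  step-tab τ g₄ = refl

  tables : Table → List (Fin 5) → List Table
  tables τ []       = [ τ ]
  tables τ (k ∷ ks) = τ ∷ tables (step τ k) ks

  word : Word → Table → Word
  word x τ = x · extend τ

  word-tab : ∀ x {π} → Fixes≥4 π → word x (tab π) ≡ x · π
  word-tab x {π} = ·extend-tab x {π}

  word-step : ∀ x τ k → word x (step τ k) ≡ word x τ · ⟦ gen k ⟧
  word-step x τ k = trans (cong (word x) (step-tab τ k))
    (trans (word-tab x {extend τ ∘ ⟦ gen k ⟧} (cong (extend τ) ∘ gen-fixes k)) (sym (·-∘ x (extend τ) ⟦ gen k ⟧)))

  Bijective : Table → Set
  Bijective τ = ∀ {p q} → extend τ p ≡ extend τ q → p ≡ q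

  Bijective-step : ∀ {τ} → Bijective τ → ∀ k → Bijective (step τ k)
  Bijective-step {τ} bij k {p} {q} e rewrite step-tab τ k = ⟦⟧-injective (gen k)
    (bij (trans (sym (extend-tab {extend τ ∘ ⟦ gen k ⟧} (cong (extend τ) ∘ gen-fixes k) p))
           (trans e (extend-tab {extend τ ∘ ⟦ gen k ⟧} (cong (extend τ) ∘ gen-fixes k) q))))

  tables-bijective : ∀ {τ} → Bijective τ → ∀ ks → All Bijective (tables τ ks)
  tables-bijective bij []       = bij ∷ []
  tables-bijective bij (k ∷ ks) = bij ∷ tables-bijective (Bijective-step bij k) ks

  walk : Word → Table → List (Fin 5) → List Word
  walk x τ ks = map (word x) (tables τ ks)

  Adj-step : ∀ {x τ} → IsPermutation x → Bijective τ → ∀ k → Adj (word x τ) (word x (step τ k))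
  Adj-step {x} {τ} px bij k = subst (Adj (word x τ)) (sym (word-step x τ k)) (Adj-·⟦⟧ (IsPermutation-· px bij) (gen k))

  walk-linked : ∀ {x τ} → IsPermutation x → Bijective τ → ∀ ks → Linked Adj (walk x τ ks)
  walk-linked px bij []            = [-]
  walk-linked px bij (k ∷ [])      = Adj-step px bij k ∷ [-]
  walk-linked px bij (k ∷ k′ ∷ ks) = Adj-step px bij k ∷ walk-linked px (Bijective-step bij k) (k′ ∷ ks)

  walk-starts : ∀ x τ ks → head (walk x τ ks) ≡ just (word x τ)
  walk-starts x τ []      = refl
  walk-starts x τ (_ ∷ _) = refl

  walk-ends : ∀ x {τ σ} ks → last (tables τ ks) ≡ just σ → last (walk x τ ks) ≡ just (word x σ)
  walk-ends x {τ} ks e = trans (List.last-map (word x) (tables τ ks)) (cong (Data.Maybe.map (word x)) e)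

  walk-unique : ∀ {x} → IsPermutation x → ∀ τ ks → Unique (tables τ ks) → Unique (walk x τ ks)
  walk-unique px τ ks = Unique.map⁺ (·extend-injective px)

  Level-word : ∀ {x τ} → IsPermutation x → Bijective τ → Level pos₃ x (word x τ)
  Level-word {x} {τ} px bij = mkLevel (IsPermutation-· px bij) agree
    where
    agree : ∀ p → 3 ℕ.< toℕ p → lookup (word x τ) p ≡ lookup x p
    agree (suc (suc (suc (suc q)))) _ = lookup-· x (extend τ) (suc (suc (suc (suc q))))
    agree zero                   ()
    agree (suc zero)             (s≤s ())
    agree (suc (suc zero))       (s≤s (s≤s ()))
    agree (suc (suc (suc zero))) (s≤s (s≤s (s≤s ())))

  walk-within : ∀ {x τ} → IsPermutation x → Bijective τ → ∀ ks {z} → z ∈ walk x τ ks → Level pos₃ x z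
  walk-within {x} {τ} px bij ks z∈ with σ , σ∈ , refl ← ∈-map⁻ (word x) z∈ =
    Level-word px (All.lookup (tables-bijective bij ks) σ∈)

  walk-covers : ∀ {x} → IsPermutation x → ∀ τ ks → (∀ a b c → tab (vertex a b c) ∈ tables τ ks) →
                ∀ {z} → Level pos₃ x z → z ∈ walk x τ ks
  walk-covers {x} px τ ks covers lz =
    let a , b , c , z≡ = level-pos₃ px lz
    in subst (_∈ walk x τ ks) (trans (word-tab x {vertex a b c} (vertex-fixes a b c)) (sym z≡)) (∈-map⁺ (word x) (covers a b c))

  rung : Fin 4 → Fin 4 → Fin 4 → Pos → Pos
  rung a b c = vertex a b c ∘ swap₀₁

  Clash : Fin 5 → Fin 4 → Fin 4 → Fin 4 → Set
  Clash k a b c = (tab ⟦ gen k ⟧ ≡ tab (vertex a b c) ⊎ tab ⟦ gen k ⟧ ≡ tab (rung a b c))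
                ⊎ (tab id ≡ tab (vertex a b c) ⊎ tab id ≡ tab (rung a b c))

  -- The tables ts describe a Hamiltonian path of level pos₃ from x·⟦gen k⟧ to x that uses every rung
  -- p — p·swap₀₁ disjoint from its end edge.
  Certificate : Fin 5 → List (Fin 5) → Set
  Certificate k ks = Unique ts × last ts ≡ just (tab id) × (∀ a b c → tab (vertex a b c) ∈ ts) ×
                     (∀ a b c → Clash k a b c ⊎ UsesEdge (tab (vertex a b c)) (tab (rung a b c)) ts)
    where ts = tables (tab ⟦ gen k ⟧) ks

  certificate? : ∀ k ks → Dec (Certificate k ks)
  certificate? k ks = unique? ts ×-dec Maybe.≡-dec _≟ᵗ_ (last ts) (just (tab id))
                      ×-dec all³? (λ a b c → tab (vertex a b c) ∈? ts)
                      ×-dec all³? (λ a b c → clash? a b c ⊎-dec usesEdge? _≟ᵗ_ (tab (vertex a b c)) (tab (rung a b c)) ts)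
    where
    open DecUnique _≟ᵗ_ using (unique?)
    open DecMembership _≟ᵗ_ using (_∈?_)
    ts = tables (tab ⟦ gen k ⟧) ks
    all³? : ∀ {P : Fin 4 → Fin 4 → Fin 4 → Set} → (∀ a b c → Dec (P a b c)) → Dec (∀ a b c → P a b c)
    all³? P? = FP.all? λ a → FP.all? λ b → FP.all? λ c → P? a b c
    clash? : ∀ a b c → Dec (Clash k a b c)
    clash? a b c = ((tab ⟦ gen k ⟧ ≟ᵗ tab (vertex a b c)) ⊎-dec (tab ⟦ gen k ⟧ ≟ᵗ tab (rung a b c)))
              ⊎-dec ((tab id ≟ᵗ tab (vertex a b c)) ⊎-dec (tab id ≟ᵗ tab (rung a b c)))

  -- Found by computer search. Each walk alternates rule-(i) steps g₀ with other steps, so it contains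
  -- all twelve rungs except possibly the one through x.
  steps : Fin 5 → List (Fin 5)
  steps g₀ = g₁ ∷ g₀ ∷ g₂ ∷ g₀ ∷ g₁ ∷ g₀ ∷ g₂ ∷ g₀ ∷ g₄ ∷ g₀ ∷ g₃ ∷ g₀ ∷ g₁ ∷ g₀ ∷ g₂ ∷ g₀ ∷ g₁ ∷ g₀ ∷ g₂ ∷ g₀ ∷ g₄ ∷ g₀ ∷ g₃ ∷ []
  steps g₁ = g₀ ∷ g₂ ∷ g₀ ∷ g₁ ∷ g₀ ∷ g₂ ∷ g₀ ∷ g₄ ∷ g₀ ∷ g₃ ∷ g₀ ∷ g₁ ∷ g₀ ∷ g₂ ∷ g₀ ∷ g₁ ∷ g₀ ∷ g₂ ∷ g₀ ∷ g₄ ∷ g₀ ∷ g₃ ∷ g₀ ∷ []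
  steps g₂ = g₀ ∷ g₁ ∷ g₀ ∷ g₂ ∷ g₀ ∷ g₁ ∷ g₀ ∷ g₃ ∷ g₀ ∷ g₄ ∷ g₀ ∷ g₂ ∷ g₀ ∷ g₁ ∷ g₀ ∷ g₂ ∷ g₀ ∷ g₁ ∷ g₀ ∷ g₃ ∷ g₀ ∷ g₄ ∷ g₀ ∷ []
  steps g₃ = g₀ ∷ g₁ ∷ g₀ ∷ g₂ ∷ g₀ ∷ g₁ ∷ g₀ ∷ g₂ ∷ g₀ ∷ g₄ ∷ g₀ ∷ g₃ ∷ g₀ ∷ g₁ ∷ g₀ ∷ g₂ ∷ g₀ ∷ g₁ ∷ g₀ ∷ g₂ ∷ g₀ ∷ g₄ ∷ g₀ ∷ []
  steps g₄ = g₀ ∷ g₁ ∷ g₀ ∷ g₂ ∷ g₀ ∷ g₁ ∷ g₀ ∷ g₃ ∷ g₀ ∷ g₄ ∷ g₀ ∷ g₂ ∷ g₀ ∷ g₃ ∷ g₀ ∷ g₁ ∷ g₀ ∷ g₄ ∷ g₀ ∷ g₃ ∷ g₀ ∷ g₁ ∷ g₀ ∷ []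

  -- Opaque, so that conversion checking never re-runs the decision procedure.
  opaque
    certified : ∀ k → Certificate k (steps k)
    certified = toWitness {a? = FP.all? λ k → certificate? k (steps k)} tt

  word-id : ∀ x → word x (tab id) ≡ x
  word-id x = trans (word-tab x {id} (λ _ → refl)) (·-id x)

  word-gen : ∀ x k → word x (tab ⟦ gen k ⟧) ≡ x · ⟦ gen k ⟧
  word-gen x k = word-tab x {⟦ gen k ⟧} (gen-fixes k)

  word-vertex : ∀ x a b c → word x (tab (vertex a b c)) ≡ x · vertex a b c
  word-vertex x a b c = word-tab x {vertex a b c} (vertex-fixes a b c)

  word-rung : ∀ x a b c → word x (tab (rung a b c)) ≡ x · vertex a b c · swap₀₁
  word-rung x a b c = trans (word-tab x {rung a b c} (vertex-fixes a b c)) (sym (·-∘ x (vertex a b c) swap₀₁))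


  walk-path : ∀ {x} → IsPermutation x → ∀ k → HamPath (Level pos₃ x) (x · ⟦ gen k ⟧) x (walk x (tab ⟦ gen k ⟧) (steps k))
  walk-path {x} px k = let unique , ends , covers , _ = certified k in record
    { starts = trans (walk-starts x τ (steps k)) (cong just (word-gen x k))
    ; ends   = trans (walk-ends x (steps k) ends) (cong just (word-id x))
    ; unique = walk-unique px τ (steps k) unique
    ; linked = walk-linked px bij (steps k)
    ; within = walk-within px bij (steps k)
    ; covers = walk-covers px τ (steps k) covers
    }
    where
    τ = tab ⟦ gen k ⟧
    bij : Bijective τ
    bij {p} {q} e = ⟦⟧-injective (gen k)
      (trans (sym (extend-tab {⟦ gen k ⟧} (gen-fixes k) p)) (trans e (extend-tab {⟦ gen k ⟧} (gen-fixes k) q)))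

  walk-rung : ∀ {x} → IsPermutation x → ∀ k a b c → Apart x (x · ⟦ gen k ⟧) (x · vertex a b c) →
              UsesEdge (x · vertex a b c) (x · vertex a b c · swap₀₁) (walk x (tab ⟦ gen k ⟧) (steps k))
  walk-rung {x} px k a b c (x≢p , x≢p′ , y≢p , y≢p′) with certified k
  ... | _ , _ , _ , rungs with rungs a b c
  ...   | inj₁ (inj₁ (inj₁ e)) = contradiction (trans (sym (word-gen x k)) (trans (cong (word x) e) (word-vertex x a b c))) y≢p
  ...   | inj₁ (inj₁ (inj₂ e)) = contradiction (trans (sym (word-gen x k)) (trans (cong (word x) e) (word-rung x a b c))) y≢p′
  ...   | inj₁ (inj₂ (inj₁ e)) = contradiction (trans (sym (word-id x)) (trans (cong (word x) e) (word-vertex x a b c))) x≢p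
  ...   | inj₁ (inj₂ (inj₂ e)) = contradiction (trans (sym (word-id x)) (trans (cong (word x) e) (word-rung x a b c))) x≢p′
  ...   | inj₂ e = subst₂ (λ u v → UsesEdge u v (walk x (tab ⟦ gen k ⟧) (steps k)))
                     (word-vertex x a b c) (word-rung x a b c) (UsesEdge-map (word x) _ e)

  base : HamPathThrough pos₃
  base w x y p lx ly x~y lp =
    let px = isPermutation lx
        g , y≡xg = Adj⇒·⟦⟧ x~y
        k , g≗ = as-gen g (Level-pivot-≤ (s≤s z≤n) (Level-refl px) g (subst (Level pos₃ x) y≡xg (Level-recentre lx ly)))
        a , b , c , p≡ = level-pos₃ px (Level-recentre lx lp)
    in subst₂ (λ y p → Apart x y p → Σ (List Word) λ L → HamPath (Level pos₃ w) y x L × UsesEdge p (p · swap₀₁) L)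
         (sym (trans y≡xg (·-cong x g≗))) (sym p≡)
         (λ apart → walk x (tab ⟦ gen k ⟧) (steps k) ,
                    HamPath-cong (Level-trans lx , Level-recentre lx) (walk-path px k) , walk-rung px k a b c apart)

module Top (m : ℕ) where

  open Network m
  open Levels m
  open Chains m
  open Step m
  open Base m
  open HamiltonianPaths (Adj {N})

  hamPathThrough : ∀ j {t : Pos} → toℕ t ≡ 3 ℕ.+ j → HamPathThrough t
  hamPathThrough zero    {t} t≡3 = subst HamPathThrough (FP.toℕ-injective {i = pos₃} (sym t≡3)) base
  hamPathThrough (suc j) {t} t≡  =
    InductionStep.step t t′ (trans (cong suc (FP.toℕ-fromℕ< j<N)) (sym t≡)) (subst (4 ℕ.≤_) (sym t≡) (s≤s (s≤s (s≤s (s≤s z≤n)))))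
      (hamPathThrough j (FP.toℕ-fromℕ< j<N))
    where
    j<N : 3 ℕ.+ j ℕ.< N
    j<N = ℕP.<-trans ℕP.≤-refl (subst (ℕ._< N) t≡ (FP.toℕ<n t))
    t′ : Pos
    t′ = F.fromℕ< j<N

  top penultimate : Pos
  top         = F.fromℕ (4 ℕ.+ m)
  penultimate = F.inject₁ (F.fromℕ (3 ℕ.+ m))

  toℕ-top : toℕ top ≡ 4 ℕ.+ m
  toℕ-top = FP.toℕ-fromℕ _

  toℕ-penultimate : toℕ penultimate ≡ 3 ℕ.+ m
  toℕ-penultimate = trans (FP.toℕ-inject₁ _) (FP.toℕ-fromℕ _)

  4≤top : 4 ℕ.≤ toℕ top
  4≤top = subst (4 ℕ.≤_) (sym toℕ-top) (s≤s (s≤s (s≤s (s≤s z≤n))))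

  last-is-top : ∀ {p : Pos} → suc (toℕ p) ≡ N → p ≡ top
  last-is-top e = FP.toℕ-injective (trans (ℕP.suc-injective e) (sym toℕ-top))

  Level-top : ∀ {w x} → IsPermutation x → Level top w x
  Level-top px = mkLevel px λ p top<p →
    contradiction (ℕP.<-≤-trans (subst (ℕ._< toℕ p) toℕ-top top<p) (ℕP.≤-pred (FP.toℕ<n p))) (ℕP.<-irrefl refl)

  Available-top : ∀ {w} → IsPermutation w → ∀ s → Available top w s
  Available-top pw s = let q , e = lookup-surjective pw s in
    q , subst (toℕ q ℕ.≤_) (sym toℕ-top) (ℕP.≤-pred (FP.toℕ<n q)) , e

  module Cycle {k} (i : Fin k → Pos) (i-injective : Injective _≡_ _≡_ i) (t : Fin k) (u : Word) (pu : IsPermutation u) where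

    open Chaining top penultimate (trans (cong suc toℕ-penultimate) (sym toℕ-top)) 4≤top
                  (hamPathThrough m toℕ-penultimate) u pu

    other? : ∀ s → Dec (s ≢ i t)
    other? s = ¬? (s FP.≟ i t)

    others : List Pos
    others = filter other? (map i (allFin k))

    symbols-unique : Unique (i t ∷ others)
    symbols-unique = All.tabulate (λ s∈ → proj₂ (∈-filter⁻ other? {xs = map i (allFin k)} s∈) ∘ sym)
                   ∷ Unique.filter⁺ other? (Unique.map⁺ i-injective (Unique.allFin⁺ k))

    symbols-sound : ∀ {s} → s ∈ i t ∷ others → Σ (Fin k) λ t′ → s ≡ i t′
    symbols-sound (here e)  = t , e
    symbols-sound (there s∈) = let t′ , _ , e = ∈-map⁻ i (proj₁ (∈-filter⁻ other? {xs = map i (allFin k)} s∈)) in t′ , e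

    symbols-complete : ∀ t′ → i t′ ∈ i t ∷ others
    symbols-complete t′ with i t′ FP.≟ i t
    ... | yes e = here e
    ... | no ne = there (∈-filter⁺ other? (∈-map⁺ i (∈-allFin t′)) ne)

    InClasses≐InSnk : InClasses (i t ∷ others) ≐ InSnk i
    InClasses≐InSnk =
      (λ (lz , s∈) → let t′ , e = symbols-sound s∈ in
                     IsPermutation.injective (isPermutation lz) , t′ , top , cong suc toℕ-top , e) ,
      (λ { {z} (pz , t′ , p , p-last , zp≡) →
           Level-top (mkPerm pz) ,
           subst (_∈ i t ∷ others) (sym (trans (cong (lookup z) (sym (last-is-top p-last))) zp≡)) (symbols-complete t′) })

    ii₂ iii₂ : Generator
    ii₂  = rule-ii pos₂ (s≤s (s≤s z≤n))
    iii₂ = rule-iii pos₂ (s≤s (s≤s z≤n))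

    in-class : ∀ g → pivot g ≡ pos₂ → lookup u top ≡ i t → InClasses (i t ∷ others) (u · ⟦ g ⟧)
    in-class g g≡pos₂ ut = Level-top (IsPermutation-·⟦⟧ pu g) ,
      here (trans (lookup-·⟦⟧ u g top (⟦⟧-fixes g (ℕP.≤-trans (s≤s (s≤s z≤n)) 4≤top) top≢pivot)) ut)
      where
      top≢pivot : top ≢ pivot g
      top≢pivot e = contradiction (trans (sym toℕ-top) (cong toℕ (trans e g≡pos₂))) λ ()

    ii≢iii : u · ⟦ ii₂ ⟧ ≢ u · ⟦ iii₂ ⟧
    ii≢iii e with () ← lookup-injective pu
      (trans (sym (lookup-· u ⟦ ii₂ ⟧ pos₀)) (trans (cong (λ z → lookup z pos₀) e) (lookup-· u ⟦ iii₂ ⟧ pos₀)))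

    third-vertex : ∀ v → lookup u top ≡ i t → Σ Word λ z → InClasses (i t ∷ others) z × z ≢ u × z ≢ v
    third-vertex v ut with v ≟ʷ u · ⟦ ii₂ ⟧
    ... | yes v≡ = u · ⟦ iii₂ ⟧ , in-class iii₂ refl ut , ≢-·⟦⟧ pu iii₂ ∘ sym , λ e → ii≢iii (trans (sym v≡) (sym e))
    ... | no v≢  = u · ⟦ ii₂ ⟧ , in-class ii₂ refl ut , ≢-·⟦⟧ pu ii₂ ∘ sym , v≢ ∘ sym

    at-least-three : ∀ {v z} vs → last (v ∷ vs) ≡ just u → z ∈ v ∷ vs → z ≢ u → z ≢ v → u ≢ v →
                     Σ Word λ a → Σ Word λ b → Σ (List Word) λ rest → vs ≡ a ∷ b ∷ rest
    at-least-three []            refl _                z≢u z≢v u≢v = contradiction refl u≢v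
    at-least-three (_ ∷ [])      refl (here z≡v)       z≢u z≢v u≢v = contradiction z≡v z≢v
    at-least-three (_ ∷ [])      refl (there (here e)) z≢u z≢v u≢v = contradiction e z≢u
    at-least-three (a ∷ b ∷ rest) _   _                _   _   _   = a , b , rest , refl

    to-cycle : ∀ {v} L → HamPath (InClasses (i t ∷ others)) v u L → Adj u v → lookup u top ≡ i t →
               Σ (HamCycle i) λ C → EdgeOf u v C
    to-cycle [] h _ _ with () ← HamPath.starts h
    to-cycle {v} (v′ ∷ vs) h u~v ut with refl ← HamPath.starts h =
      let linked , ys , edge = HamPath-close vs h u~v
          z , z∈ , z≢u , z≢v = third-vertex v ut
      in hamCycle v vs (at-least-three vs (HamPath.ends h) (HamPath.covers h z∈) z≢u z≢v (proj₁ u~v)) (HamPath.unique h)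
           (proj₁ InClasses≐InSnk ∘ HamPath.within h) (λ _ → HamPath.covers h ∘ proj₂ InClasses≐InSnk) linked ,
         ys , [] , inj₁ edge

    cycle : ∀ {v} → IsPermutation v → lookup u top ≡ i t → lookup v top ≡ i t → Adj u v → Σ (HamCycle i) λ C → EdgeOf u v C
    cycle pv ut vt u~v =
      let L , h , _ = chain (i t) others symbols-unique (All.tabulate λ _ → Available-top pu _) nothing
                            (Level-top pu , ut) (Level-top pv , vt) u~v tt
      in to-cycle L h u~v ut

lemma2p11 : (n k : ℕ) → 5 ≤ n → 1 ≤ k → k ≤ n →
            (i : Fin k → Fin n) → Injective _≡_ _≡_ i →
            (t : Fin k) → (u v : Vec (Fin n) n) →
            IsPerm u → IsPerm v → LastIs u (i t) → LastIs v (i t) → Adj u v →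
            Σ (HamCycle i) (λ C → EdgeOf u v C)
lemma2p11 _ _ (s≤s (s≤s (s≤s (s≤s (s≤s {n = m} z≤n))))) _ _ i i-injective t u v pu pv (p , p-last , u-ends) (q , q-last , v-ends) u~v =
  Cycle.cycle i i-injective t u (mkPerm pu) (mkPerm pv)
    (subst (λ r → lookup u r ≡ i t) (last-is-top p-last) u-ends)
    (subst (λ r → lookup v r ≡ i t) (last-is-top q-last) v-ends) u~v
  where
  open Network m using (mkPerm)
  open Top m using (module Cycle; last-is-top)
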